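{- For $n\ge 0$ let $$C_n=\sum_{k=0}^n q^{k^2+k}\begin{bmatrix} n\\ k\end{bmatrix},\qquad D_n=\sum_{j\in\mathbb{Z}}(-1)^j q^{\frac{j(5j-3)}{2}}\begin{bmatrix} 2n+1\\ n+1-2j\end{bmatrix}.$$ Then for every integer $n\ge 2$ both sequences satisfy the same three-term recursion: $$C_n-(1+q-q^n+q^{2n})C_{n-1}+q(1-q^{n-1})C_{n-2}=0,$$ $$D_n-(1+q-q^n+q^{2n})D_{n-1}+q(1-q^{n-1})D_{n-2}=0.$$
   Context: $q$ is an indeterminate. For integers $n,k$, $\begin{bmatrix} n\\ k\end{bmatrix}$ denotes the Gaussian ($q$-)binomial coefficient $\frac{(q;q)_n}{(q;q)_k(q;q)_{n-k}}$ for $0\le k\le n$ and $0$ otherwise, where $(x;q)_m=(1-x)(1-xq)\cdots(1-xq^{m-1})$. -}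

module Defs where

-- Identities in ℤ[q] are stated in the formal power series ring ℤ[[q]]
-- (coefficient functions ℕ → ℤ), which contains ℤ[q] as a subring.
-- In ℤ[[q]] every (q;q)_m is invertible, so the Gaussian binomial can be
-- defined literally as (q;q)_n / ((q;q)_k (q;q)_{n-k}).

open import Data.Nat as ℕ using (ℕ; zero; suc; _≤?_; _∸_; _%_; _≡ᵇ_)
open import Data.Integer as ℤ using (ℤ; +_; -[1+_]; ∣_∣; 0ℤ; 1ℤ; -1ℤ)
open import Data.List using (List; []; _∷_; map; foldr; upTo)
open import Data.Bool using (if_then_else_)
open import Relation.Nullary using (yes; no)
open import Relation.Binary.PropositionalEquality using (_≡_)

PS : Set
PS = ℕ → ℤ

_≋_ : PS → PS → Set
f ≋ g = ∀ n → f n ≡ g n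
infix 4 _≋_

sumℤ : List ℤ → ℤ
sumℤ = foldr ℤ._+_ 0ℤ

const : ℤ → PS
const c zero = c
const c (suc _) = 0ℤ

zeroPS : PS
zeroPS = const 0ℤ

onePS : PS
onePS = const 1ℤ

mon : ℕ → PS
mon k n = if n ≡ᵇ k then 1ℤ else 0ℤ

_⊕_ : PS → PS → PS
(f ⊕ g) n = f n ℤ.+ g n

_⊖_ : PS → PS → PS
(f ⊖ g) n = f n ℤ.- g n

_⊛_ : PS → PS → PS
(f ⊛ g) n = sumℤ (map (λ i → f i ℤ.* g (n ∸ i)) (upTo (suc n)))

infixl 7 _⊛_
infixl 6 _⊕_ _⊖_

sumPS : List PS → PS
sumPS = foldr _⊕_ zeroPS

prodPS : List PS → PS
prodPS = foldr _⊛_ onePS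

poch : ℕ → PS
poch m = prodPS (map (λ i → onePS ⊖ mon (suc i)) (upTo m))

-- 1/(1 - q^{t+1}) = Σ_s q^{(t+1)s}
geom : ℕ → PS
geom t n = if (n % suc t) ≡ᵇ 0 then 1ℤ else 0ℤ

invPoch : ℕ → PS
invPoch m = prodPS (map geom (upTo m))

gauss : ℕ → ℕ → PS
gauss n k with k ≤? n
... | yes _ = poch n ⊛ invPoch k ⊛ invPoch (n ∸ k)
... | no _ = zeroPS

gaussℤ : ℕ → ℤ → PS
gaussℤ n (+ k) = gauss n k
gaussℤ n -[1+ _ ] = zeroPS

C : ℕ → PS
C n = sumPS (map (λ k → mon (k ℕ.* k ℕ.+ k) ⊛ gauss n k) (upTo (suc n)))

-- j(5j-3)/2, a natural number for every integer j
expD : ℤ → ℕ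
expD j = ℕ._/_ ∣ j ℤ.* (+ 5 ℤ.* j ℤ.- + 3) ∣ 2

-- the integers -(n+1), ..., n+1; outside this range the summand of D_n is 0
rangeD : ℕ → List ℤ
rangeD n = map (λ i → + i ℤ.- + suc n) (upTo (suc (suc (suc (2 ℕ.* n)))))

D : ℕ → PS
D n = sumPS (map (λ j → const (-1ℤ ℤ.^ ∣ j ∣) ⊛ mon (expD j)
                        ⊛ gaussℤ (suc (2 ℕ.* n)) (+ suc n ℤ.- + 2 ℤ.* j))
                 (rangeD n))

recOp : (ℕ → PS) → ℕ → PS
recOp X n = X n ⊖ (onePS ⊕ mon 1 ⊖ mon n ⊕ mon (2 ℕ.* n)) ⊛ X (n ∸ 1)
                ⊕ mon 1 ⊛ (onePS ⊖ mon (n ∸ 1)) ⊛ X (n ∸ 2)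

-- Work in ℤ[[q]], where every (q;q)_m is invertible, so that the q-Pascal rules
--   [n+1, k] = [n, k-1] + q^k [n, k] = [n, k] + q^(n+1-k) [n, k-1]
-- are ring identities. Both C_n and D_n are sums Σ_{|j| ≤ N} g(j) q^(e(j)/2) [T, k(j)], and applying a
-- Pascal rule to every term, followed by j ↦ j + 1 or by j ↦ -j together with [T, k] = [T, T - k],
-- expresses such a sum at level m + 1 through sums at level m with raised exponents.
-- For C^a_m = Σ_j q^(j² + aj) [m, j] (so C_m = C^1_m) this gives
--   C^a_{m+1} = C^a_m + q^(m+1+a) C^(a+1)_m = C^(a+1)_m + q^(a+1) C^(a+2)_m.
-- For D_m and its companion E_m = Σ_j (-1)^j q^(j(5j-1)/2) [2m+1, m+1-2j] it gives
--   D_{m+1} = D_m + q^(m+1) E_m - q^(m+1) D_m + q^(2m+2) D_m,   E_{m+1} = E_m + q^(m+1) D_m,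
-- where a leftover sum vanishes because j ↦ 1 - j changes its sign. In both cases the left-hand side of
-- the recursion at n = m + 2 is an explicit linear combination of these relations.

module Submission where

open import Defs

open import Algebra.Bundles using (CommutativeRing)
open import Algebra.Structures {A = PS} _≋_ using (IsCommutativeRing)
open import Algebra.Solver.Ring.AlmostCommutativeRing
  using (AlmostCommutativeRing; fromCommutativeRing; _-Raw-AlmostCommutative⟶_)
open import Data.Bool using (if_then_else_)
open import Data.Empty using (⊥-elim)
open import Data.Integer as ℤ using (ℤ; +_; -[1+_]; ∣_∣; 0ℤ; 1ℤ; -1ℤ; +≤+)
import Data.Integer.Properties as ℤP
open import Data.Integer.Tactic.RingSolver using (solve-∀)
open import Data.List using ([]; _∷_; map; upTo; applyUpTo; _∷ʳ_)
open import Data.List.Properties using (map-upTo; map-∘; map-++; upTo-∷ʳ)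
open import Data.Maybe using (Maybe; just; nothing)
open import Data.Nat as ℕ using (ℕ; zero; suc; _∸_; _%_; _≡ᵇ_; _<_; _≤_; z≤n; s≤s; _≤?_; _≤′_; ≤′-refl; ≤′-step)
import Data.Nat.Properties as ℕP
open import Data.Nat.DivMod using (m<n⇒m%n≡m; [m+n]%n≡m%n; +-distrib-/-∣ʳ; m*n/n≡m)
open import Data.Nat.Divisibility using (divides)
open import Data.Product using (_×_; _,_; proj₁; proj₂)
open import Data.Sum using (inj₁; inj₂)
open import Level using (0ℓ)
open import Relation.Binary.Definitions using (tri<; tri≈; tri>)
open import Relation.Binary.PropositionalEquality
import Relation.Binary.Reasoning.Setoid as SetoidReasoning
open import Relation.Nullary using (yes; no)

-- ℤ[[q]] as a commutative ring

tail : PS → PS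
tail f n = f (suc n)

negPS : PS → PS
negPS f n = ℤ.- f n

zeroPS-coeff : ∀ n → zeroPS n ≡ 0ℤ
zeroPS-coeff zero    = refl
zeroPS-coeff (suc n) = refl

≋-refl : ∀ {f} → f ≋ f
≋-refl n = refl

≋-sym : ∀ {f g} → f ≋ g → g ≋ f
≋-sym p n = sym (p n)

≋-trans : ∀ {f g h} → f ≋ g → g ≋ h → f ≋ h
≋-trans p q n = trans (p n) (q n)

⊕-cong : ∀ {f f′ g g′} → f ≋ f′ → g ≋ g′ → f ⊕ g ≋ f′ ⊕ g′
⊕-cong p q n = cong₂ ℤ._+_ (p n) (q n)

⊛-coeff-zero : ∀ f g → (f ⊛ g) 0 ≡ f 0 ℤ.* g 0
⊛-coeff-zero f g = ℤP.+-identityʳ _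

⊛-coeff-suc : ∀ f g n → (f ⊛ g) (suc n) ≡ f 0 ℤ.* g (suc n) ℤ.+ (tail f ⊛ g) n
⊛-coeff-suc f g n = trans (unfold f g (suc n)) (cong (λ x → f 0 ℤ.* g (suc n) ℤ.+ x) (sym (unfold (tail f) g n)))
  where
  unfold : ∀ f g n → (f ⊛ g) n ≡ sumℤ (applyUpTo (λ i → f i ℤ.* g (n ∸ i)) (suc n))
  unfold f g n = cong sumℤ (map-upTo (λ i → f i ℤ.* g (n ∸ i)) (suc n))

⊛-coeff-sucʳ : ∀ f g n → (f ⊛ g) (suc n) ≡ (f ⊛ tail g) n ℤ.+ f (suc n) ℤ.* g 0
⊛-coeff-sucʳ f g zero = begin
  (f ⊛ g) 1                        ≡⟨ ⊛-coeff-suc f g 0 ⟩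
  f 0 ℤ.* g 1 ℤ.+ (tail f ⊛ g) 0   ≡⟨ cong (λ x → f 0 ℤ.* g 1 ℤ.+ x) (⊛-coeff-zero (tail f) g) ⟩
  f 0 ℤ.* g 1 ℤ.+ f 1 ℤ.* g 0      ≡⟨ cong (ℤ._+ f 1 ℤ.* g 0) (sym (⊛-coeff-zero f (tail g))) ⟩
  (f ⊛ tail g) 0 ℤ.+ f 1 ℤ.* g 0   ∎
  where open ≡-Reasoning
⊛-coeff-sucʳ f g (suc n) = begin
  (f ⊛ g) (2 ℕ.+ n)
    ≡⟨ ⊛-coeff-suc f g (suc n) ⟩
  f 0 ℤ.* g (2 ℕ.+ n) ℤ.+ (tail f ⊛ g) (suc n)
    ≡⟨ cong (λ x → f 0 ℤ.* g (2 ℕ.+ n) ℤ.+ x) (⊛-coeff-sucʳ (tail f) g n) ⟩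
  f 0 ℤ.* g (2 ℕ.+ n) ℤ.+ ((tail f ⊛ tail g) n ℤ.+ f (2 ℕ.+ n) ℤ.* g 0)
    ≡⟨ sym (ℤP.+-assoc (f 0 ℤ.* g (2 ℕ.+ n)) _ _) ⟩
  f 0 ℤ.* g (2 ℕ.+ n) ℤ.+ (tail f ⊛ tail g) n ℤ.+ f (2 ℕ.+ n) ℤ.* g 0
    ≡⟨ cong (ℤ._+ f (2 ℕ.+ n) ℤ.* g 0) (sym (⊛-coeff-suc f (tail g) n)) ⟩
  (f ⊛ tail g) (suc n) ℤ.+ f (2 ℕ.+ n) ℤ.* g 0
    ∎
  where open ≡-Reasoning

⊛-congʳ : ∀ {f f′} g → f ≋ f′ → f ⊛ g ≋ f′ ⊛ g
⊛-congʳ {f} {f′} g p zero = begin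
  (f ⊛ g) 0       ≡⟨ ⊛-coeff-zero f g ⟩
  f 0 ℤ.* g 0     ≡⟨ cong (ℤ._* g 0) (p 0) ⟩
  f′ 0 ℤ.* g 0    ≡⟨ sym (⊛-coeff-zero f′ g) ⟩
  (f′ ⊛ g) 0      ∎
  where open ≡-Reasoning
⊛-congʳ {f} {f′} g p (suc n) = begin
  (f ⊛ g) (suc n)                          ≡⟨ ⊛-coeff-suc f g n ⟩
  f 0 ℤ.* g (suc n) ℤ.+ (tail f ⊛ g) n      ≡⟨ cong₂ (λ a b → a ℤ.* g (suc n) ℤ.+ b) (p 0) (⊛-congʳ g (λ i → p (suc i)) n) ⟩
  f′ 0 ℤ.* g (suc n) ℤ.+ (tail f′ ⊛ g) n    ≡⟨ sym (⊛-coeff-suc f′ g n) ⟩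
  (f′ ⊛ g) (suc n)                         ∎
  where open ≡-Reasoning

⊛-congˡ : ∀ f {g g′} → g ≋ g′ → f ⊛ g ≋ f ⊛ g′
⊛-congˡ f {g} {g′} p zero = begin
  (f ⊛ g) 0       ≡⟨ ⊛-coeff-zero f g ⟩
  f 0 ℤ.* g 0     ≡⟨ cong (f 0 ℤ.*_) (p 0) ⟩
  f 0 ℤ.* g′ 0    ≡⟨ sym (⊛-coeff-zero f g′) ⟩
  (f ⊛ g′) 0      ∎
  where open ≡-Reasoning
⊛-congˡ f {g} {g′} p (suc n) = begin
  (f ⊛ g) (suc n)                          ≡⟨ ⊛-coeff-suc f g n ⟩
  f 0 ℤ.* g (suc n) ℤ.+ (tail f ⊛ g) n      ≡⟨ cong₂ (λ a b → f 0 ℤ.* a ℤ.+ b) (p (suc n)) (⊛-congˡ (tail f) p n) ⟩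
  f 0 ℤ.* g′ (suc n) ℤ.+ (tail f ⊛ g′) n    ≡⟨ sym (⊛-coeff-suc f g′ n) ⟩
  (f ⊛ g′) (suc n)                         ∎
  where open ≡-Reasoning

⊛-cong : ∀ {f f′ g g′} → f ≋ f′ → g ≋ g′ → f ⊛ g ≋ f′ ⊛ g′
⊛-cong {f′ = f′} {g = g} p q = ≋-trans (⊛-congʳ g p) (⊛-congˡ f′ q)

⊛-scaleˡ : ∀ c f g n → ((λ i → c ℤ.* f i) ⊛ g) n ≡ c ℤ.* (f ⊛ g) n
⊛-scaleˡ c f g zero = begin
  ((λ i → c ℤ.* f i) ⊛ g) 0 ≡⟨ ⊛-coeff-zero (λ i → c ℤ.* f i) g ⟩
  (c ℤ.* f 0) ℤ.* g 0   ≡⟨ ℤP.*-assoc c (f 0) (g 0) ⟩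
  c ℤ.* (f 0 ℤ.* g 0)   ≡⟨ cong (c ℤ.*_) (sym (⊛-coeff-zero f g)) ⟩
  c ℤ.* (f ⊛ g) 0       ∎
  where open ≡-Reasoning
⊛-scaleˡ c f g (suc n) = begin
  ((λ i → c ℤ.* f i) ⊛ g) (suc n)
    ≡⟨ ⊛-coeff-suc (λ i → c ℤ.* f i) g n ⟩
  c ℤ.* f 0 ℤ.* g (suc n) ℤ.+ ((λ i → c ℤ.* tail f i) ⊛ g) n
    ≡⟨ cong (λ x → c ℤ.* f 0 ℤ.* g (suc n) ℤ.+ x) (⊛-scaleˡ c (tail f) g n) ⟩
  c ℤ.* f 0 ℤ.* g (suc n) ℤ.+ c ℤ.* (tail f ⊛ g) n
    ≡⟨ factor c (f 0) (g (suc n)) _ ⟩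
  c ℤ.* (f 0 ℤ.* g (suc n) ℤ.+ (tail f ⊛ g) n)
    ≡⟨ cong (c ℤ.*_) (sym (⊛-coeff-suc f g n)) ⟩
  c ℤ.* (f ⊛ g) (suc n)
    ∎
  where
  open ≡-Reasoning
  factor : ∀ c a b x → c ℤ.* a ℤ.* b ℤ.+ c ℤ.* x ≡ c ℤ.* (a ℤ.* b ℤ.+ x)
  factor = solve-∀

⊛-vanishingˡ : ∀ f g → (∀ i → f i ≡ 0ℤ) → ∀ n → (f ⊛ g) n ≡ 0ℤ
⊛-vanishingˡ f g z zero    = trans (⊛-coeff-zero f g) (cong (ℤ._* g 0) (z 0))
⊛-vanishingˡ f g z (suc n) = trans (⊛-coeff-suc f g n)
  (cong₂ (λ a b → a ℤ.* g (suc n) ℤ.+ b) (z 0) (⊛-vanishingˡ (tail f) g (λ i → z (suc i)) n))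

const-⊛ : ∀ c g n → (const c ⊛ g) n ≡ c ℤ.* g n
const-⊛ c g zero    = ⊛-coeff-zero (const c) g
const-⊛ c g (suc n) = trans (⊛-coeff-suc (const c) g n)
  (trans (cong (λ x → c ℤ.* g (suc n) ℤ.+ x) (⊛-vanishingˡ (tail (const c)) g (λ _ → refl) n)) (ℤP.+-identityʳ _))

⊛-identityˡ : ∀ g → onePS ⊛ g ≋ g
⊛-identityˡ g n = trans (const-⊛ 1ℤ g n) (ℤP.*-identityˡ (g n))

⊛-distribʳ : ∀ f g h → (f ⊕ g) ⊛ h ≋ f ⊛ h ⊕ g ⊛ h
⊛-distribʳ f g h zero = begin
  ((f ⊕ g) ⊛ h) 0                  ≡⟨ ⊛-coeff-zero (f ⊕ g) h ⟩
  (f 0 ℤ.+ g 0) ℤ.* h 0            ≡⟨ ℤP.*-distribʳ-+ (h 0) (f 0) (g 0) ⟩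
  f 0 ℤ.* h 0 ℤ.+ g 0 ℤ.* h 0      ≡⟨ sym (cong₂ ℤ._+_ (⊛-coeff-zero f h) (⊛-coeff-zero g h)) ⟩
  (f ⊛ h ⊕ g ⊛ h) 0                ∎
  where open ≡-Reasoning
⊛-distribʳ f g h (suc n) = begin
  ((f ⊕ g) ⊛ h) (suc n)
    ≡⟨ ⊛-coeff-suc (f ⊕ g) h n ⟩
  (f 0 ℤ.+ g 0) ℤ.* h (suc n) ℤ.+ ((tail f ⊕ tail g) ⊛ h) n
    ≡⟨ cong (λ x → (f 0 ℤ.+ g 0) ℤ.* h (suc n) ℤ.+ x) (⊛-distribʳ (tail f) (tail g) h n) ⟩
  (f 0 ℤ.+ g 0) ℤ.* h (suc n) ℤ.+ ((tail f ⊛ h) n ℤ.+ (tail g ⊛ h) n)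
    ≡⟨ regroup (f 0) (g 0) (h (suc n)) _ _ ⟩
  (f 0 ℤ.* h (suc n) ℤ.+ (tail f ⊛ h) n) ℤ.+ (g 0 ℤ.* h (suc n) ℤ.+ (tail g ⊛ h) n)
    ≡⟨ sym (cong₂ ℤ._+_ (⊛-coeff-suc f h n) (⊛-coeff-suc g h n)) ⟩
  (f ⊛ h ⊕ g ⊛ h) (suc n)
    ∎
  where
  open ≡-Reasoning
  regroup : ∀ a b c x y → (a ℤ.+ b) ℤ.* c ℤ.+ (x ℤ.+ y) ≡ (a ℤ.* c ℤ.+ x) ℤ.+ (b ℤ.* c ℤ.+ y)
  regroup = solve-∀

⊛-comm : ∀ f g → f ⊛ g ≋ g ⊛ f
⊛-comm f g zero = begin
  (f ⊛ g) 0     ≡⟨ ⊛-coeff-zero f g ⟩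
  f 0 ℤ.* g 0   ≡⟨ ℤP.*-comm (f 0) (g 0) ⟩
  g 0 ℤ.* f 0   ≡⟨ sym (⊛-coeff-zero g f) ⟩
  (g ⊛ f) 0     ∎
  where open ≡-Reasoning
⊛-comm f g (suc n) = begin
  (f ⊛ g) (suc n)                          ≡⟨ ⊛-coeff-suc f g n ⟩
  f 0 ℤ.* g (suc n) ℤ.+ (tail f ⊛ g) n      ≡⟨ cong₂ ℤ._+_ (ℤP.*-comm (f 0) (g (suc n))) (⊛-comm (tail f) g n) ⟩
  g (suc n) ℤ.* f 0 ℤ.+ (g ⊛ tail f) n      ≡⟨ ℤP.+-comm (g (suc n) ℤ.* f 0) _ ⟩
  (g ⊛ tail f) n ℤ.+ g (suc n) ℤ.* f 0      ≡⟨ sym (⊛-coeff-sucʳ g f n) ⟩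
  (g ⊛ f) (suc n)                          ∎
  where open ≡-Reasoning

⊛-distribˡ : ∀ h f g → h ⊛ (f ⊕ g) ≋ h ⊛ f ⊕ h ⊛ g
⊛-distribˡ h f g n = begin
  (h ⊛ (f ⊕ g)) n            ≡⟨ ⊛-comm h (f ⊕ g) n ⟩
  ((f ⊕ g) ⊛ h) n            ≡⟨ ⊛-distribʳ f g h n ⟩
  (f ⊛ h ⊕ g ⊛ h) n          ≡⟨ cong₂ ℤ._+_ (⊛-comm f h n) (⊛-comm g h n) ⟩
  (h ⊛ f ⊕ h ⊛ g) n          ∎
  where open ≡-Reasoning

⊛-assoc : ∀ f g h → (f ⊛ g) ⊛ h ≋ f ⊛ (g ⊛ h)
⊛-assoc f g h zero = begin
  ((f ⊛ g) ⊛ h) 0          ≡⟨ ⊛-coeff-zero (f ⊛ g) h ⟩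
  (f ⊛ g) 0 ℤ.* h 0        ≡⟨ cong (ℤ._* h 0) (⊛-coeff-zero f g) ⟩
  f 0 ℤ.* g 0 ℤ.* h 0      ≡⟨ ℤP.*-assoc (f 0) (g 0) (h 0) ⟩
  f 0 ℤ.* (g 0 ℤ.* h 0)    ≡⟨ cong (f 0 ℤ.*_) (sym (⊛-coeff-zero g h)) ⟩
  f 0 ℤ.* (g ⊛ h) 0        ≡⟨ sym (⊛-coeff-zero f (g ⊛ h)) ⟩
  (f ⊛ (g ⊛ h)) 0          ∎
  where open ≡-Reasoning
⊛-assoc f g h (suc n) = begin
  ((f ⊛ g) ⊛ h) (suc n)
    ≡⟨ ⊛-coeff-suc (f ⊛ g) h n ⟩
  (f ⊛ g) 0 ℤ.* h (suc n) ℤ.+ (tail (f ⊛ g) ⊛ h) n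
    ≡⟨ cong₂ ℤ._+_ (cong (ℤ._* h (suc n)) (⊛-coeff-zero f g)) (⊛-congʳ h (⊛-coeff-suc f g) n) ⟩
  f 0 ℤ.* g 0 ℤ.* h (suc n) ℤ.+ (((λ i → f 0 ℤ.* tail g i) ⊕ tail f ⊛ g) ⊛ h) n
    ≡⟨ cong (λ x → f 0 ℤ.* g 0 ℤ.* h (suc n) ℤ.+ x) (⊛-distribʳ (λ i → f 0 ℤ.* tail g i) (tail f ⊛ g) h n) ⟩
  f 0 ℤ.* g 0 ℤ.* h (suc n) ℤ.+ (((λ i → f 0 ℤ.* tail g i) ⊛ h) n ℤ.+ ((tail f ⊛ g) ⊛ h) n)
    ≡⟨ cong (λ x → f 0 ℤ.* g 0 ℤ.* h (suc n) ℤ.+ x) (cong₂ ℤ._+_ (⊛-scaleˡ (f 0) (tail g) h n) (⊛-assoc (tail f) g h n)) ⟩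
  f 0 ℤ.* g 0 ℤ.* h (suc n) ℤ.+ (f 0 ℤ.* (tail g ⊛ h) n ℤ.+ (tail f ⊛ (g ⊛ h)) n)
    ≡⟨ regroup (f 0) (g 0) (h (suc n)) _ _ ⟩
  f 0 ℤ.* (g 0 ℤ.* h (suc n) ℤ.+ (tail g ⊛ h) n) ℤ.+ (tail f ⊛ (g ⊛ h)) n
    ≡⟨ cong (λ x → f 0 ℤ.* x ℤ.+ (tail f ⊛ (g ⊛ h)) n) (sym (⊛-coeff-suc g h n)) ⟩
  f 0 ℤ.* (g ⊛ h) (suc n) ℤ.+ (tail f ⊛ (g ⊛ h)) n
    ≡⟨ sym (⊛-coeff-suc f (g ⊛ h) n) ⟩
  (f ⊛ (g ⊛ h)) (suc n)
    ∎
  where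
  open ≡-Reasoning
  regroup : ∀ a b c x y → a ℤ.* b ℤ.* c ℤ.+ (a ℤ.* x ℤ.+ y) ≡ a ℤ.* (b ℤ.* c ℤ.+ x) ℤ.+ y
  regroup = solve-∀

ps-isCommutativeRing : IsCommutativeRing _⊕_ _⊛_ negPS zeroPS onePS
ps-isCommutativeRing = record
  { isRing = record
    { +-isAbelianGroup = record
      { isGroup = record
        { isMonoid = record
          { isSemigroup = record
            { isMagma = record
              { isEquivalence = record { refl = ≋-refl ; sym = ≋-sym ; trans = ≋-trans }
              ; ∙-cong = ⊕-cong }
            ; assoc = λ f g h n → ℤP.+-assoc (f n) (g n) (h n) }
          ; identity = (λ f n → trans (cong (ℤ._+ f n) (zeroPS-coeff n)) (ℤP.+-identityˡ (f n)))
                     , (λ f n → trans (cong (λ x → f n ℤ.+ x) (zeroPS-coeff n)) (ℤP.+-identityʳ (f n))) }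
        ; inverse = (λ f n → trans (ℤP.+-inverseˡ (f n)) (sym (zeroPS-coeff n)))
                  , (λ f n → trans (ℤP.+-inverseʳ (f n)) (sym (zeroPS-coeff n)))
        ; ⁻¹-cong = λ p n → cong ℤ.-_ (p n) }
      ; comm = λ f g n → ℤP.+-comm (f n) (g n) }
    ; *-cong = ⊛-cong
    ; *-assoc = ⊛-assoc
    ; *-identity = ⊛-identityˡ , (λ f → ≋-trans (⊛-comm f onePS) (⊛-identityˡ f))
    ; distrib = ⊛-distribˡ , (λ h f g → ⊛-distribʳ f g h) }
  ; *-comm = ⊛-comm }

ps-commutativeRing : CommutativeRing 0ℓ 0ℓ
ps-commutativeRing = record { isCommutativeRing = ps-isCommutativeRing }

const-homomorphism : CommutativeRing.rawRing ℤP.+-*-commutativeRing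
                     -Raw-AlmostCommutative⟶ fromCommutativeRing ps-commutativeRing
const-homomorphism = record
  { ⟦_⟧    = const
  ; +-homo = λ { a b zero → refl ; a b (suc n) → refl }
  ; *-homo = λ a b n → sym (trans (const-⊛ a (const b) n) (scale a b n))
  ; -‿homo = λ { a zero → refl ; a (suc n) → refl }
  ; 0-homo = λ { zero → refl ; (suc n) → refl }
  ; 1-homo = λ { zero → refl ; (suc n) → refl } }
  where
  scale : ∀ a b n → a ℤ.* const b n ≡ const (a ℤ.* b) n
  scale a b zero    = refl
  scale a b (suc n) = ℤP.*-zeroʳ a

const-≟ : (a b : ℤ) → Maybe (const a ≋ const b)
const-≟ a b with a ℤ.≟ b
... | yes refl = just ≋-refl
... | no _     = nothing

open import Algebra.Solver.Ring (CommutativeRing.rawRing ℤP.+-*-commutativeRing)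
  (fromCommutativeRing ps-commutativeRing) const-homomorphism const-≟

open CommutativeRing ps-commutativeRing
  using (+-assoc; +-comm; +-congˡ; +-congʳ; -‿cong; zeroʳ; +-identityˡ; +-identityʳ)

module ≋-Reasoning = SetoidReasoning (CommutativeRing.setoid ps-commutativeRing)

a+b≈a : ∀ a {b} → b ≋ zeroPS → a ⊕ b ≋ a
a+b≈a a b≈0 = ≋-trans (+-congˡ {a} b≈0) (+-identityʳ a)

⊛-vanishingʳ : ∀ a {b} → b ≋ zeroPS → a ⊛ b ≋ zeroPS
⊛-vanishingʳ a b≈0 = ≋-trans (⊛-congˡ a b≈0) (zeroʳ a)

a+m*b≈a : ∀ a m {b} → b ≋ zeroPS → a ⊕ m ⊛ b ≋ a
a+m*b≈a a m b≈0 = a+b≈a a (⊛-vanishingʳ m b≈0)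

x≈-x⇒x≈0 : ∀ {f} → f ≋ negPS f → f ≋ zeroPS
x≈-x⇒x≈0 {f} f≈-f n = trans (x≡-x⇒x≡0 (f n) (f≈-f n)) (sym (zeroPS-coeff n))
  where
  x≡-x⇒x≡0 : ∀ x → x ≡ ℤ.- x → x ≡ 0ℤ
  x≡-x⇒x≡0 (+ zero)  _ = refl
  x≡-x⇒x≡0 (+ suc n) ()
  x≡-x⇒x≡0 -[1+ n ]  ()

defect-vanishes : ∀ {f g} → f ≋ g → f ⊖ g ≋ zeroPS
defect-vanishes {f} {g} f≈g n = trans (cong (ℤ._- g n) (f≈g n)) (trans (ℤP.+-inverseʳ (g n)) (sym (zeroPS-coeff n)))

combination-vanishes : ∀ a b {u v} → u ≋ zeroPS → v ≋ zeroPS → a ⊛ u ⊕ b ⊛ v ≋ zeroPS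
combination-vanishes a b u≈0 v≈0 = ≋-trans (⊕-cong (⊛-vanishingʳ a u≈0) (⊛-vanishingʳ b v≈0)) (+-identityʳ zeroPS)

-- Monomials and the geometric series

shift : PS → PS
shift f zero    = 0ℤ
shift f (suc n) = f n

shift-cong : ∀ {f g} → f ≋ g → shift f ≋ shift g
shift-cong p zero    = refl
shift-cong p (suc n) = p n

mon-zero : mon 0 ≋ onePS
mon-zero zero    = refl
mon-zero (suc n) = refl

mon-suc : ∀ k → mon (suc k) ≋ shift (mon k)
mon-suc k zero    = refl
mon-suc k (suc n) = refl

mon-suc-⊛ : ∀ k g → mon (suc k) ⊛ g ≋ shift (mon k ⊛ g)
mon-suc-⊛ k g zero    = trans (⊛-coeff-zero (mon (suc k)) g) (ℤP.*-zeroˡ (g 0))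
mon-suc-⊛ k g (suc n) = trans (⊛-coeff-suc (mon (suc k)) g n)
  (trans (cong (ℤ._+ (mon k ⊛ g) n) (ℤP.*-zeroˡ (g (suc n)))) (ℤP.+-identityˡ _))

mon-+ : ∀ a b → mon a ⊛ mon b ≋ mon (a ℕ.+ b)
mon-+ zero    b = ≋-trans (⊛-congʳ (mon b) mon-zero) (⊛-identityˡ (mon b))
mon-+ (suc a) b = ≋-trans (mon-suc-⊛ a (mon b)) (≋-trans (shift-cong (mon-+ a b)) (≋-sym (mon-suc (a ℕ.+ b))))

mon-⊛-coeff-+ : ∀ k g m → (mon k ⊛ g) (k ℕ.+ m) ≡ g m
mon-⊛-coeff-+ zero    g m = trans (⊛-congʳ g mon-zero m) (⊛-identityˡ g m)
mon-⊛-coeff-+ (suc k) g m = trans (mon-suc-⊛ k g (suc (k ℕ.+ m))) (mon-⊛-coeff-+ k g m)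

mon-⊛-coeff-< : ∀ k g n → n < k → (mon k ⊛ g) n ≡ 0ℤ
mon-⊛-coeff-< (suc k) g zero    _         = mon-suc-⊛ k g zero
mon-⊛-coeff-< (suc k) g (suc n) (s≤s n<k) = trans (mon-suc-⊛ k g (suc n)) (mon-⊛-coeff-< k g n n<k)

geom-inverse : ∀ t → geom t ⊛ (onePS ⊖ mon (suc t)) ≋ onePS
geom-inverse t n = trans (expand n) (coeff n)
  where
  G : PS
  G = geom t
  expand : G ⊛ (onePS ⊖ mon (suc t)) ≋ G ⊖ mon (suc t) ⊛ G
  expand = solve 2 (λ G x → G :* (con 1ℤ :- x) := G :- x :* G) ≋-refl G (mon (suc t))
  geom-below : ∀ n → n % suc t ≡ n → G n ≡ onePS n
  geom-below zero    _ = refl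
  geom-below (suc n) e rewrite e = refl
  -- for n ≥ t+1 the coefficients n and n-(t+1) of G agree
  coeff-above : ∀ m → (G ⊖ mon (suc t) ⊛ G) (suc t ℕ.+ m) ≡ onePS (suc t ℕ.+ m)
  coeff-above m = begin
    G (suc t ℕ.+ m) ℤ.- (mon (suc t) ⊛ G) (suc t ℕ.+ m)
      ≡⟨ cong (λ x → G (suc t ℕ.+ m) ℤ.- x) (mon-⊛-coeff-+ (suc t) G m) ⟩
    G (suc t ℕ.+ m) ℤ.- G m
      ≡⟨ cong (λ r → (if r ≡ᵇ 0 then 1ℤ else 0ℤ) ℤ.- G m)
              (trans (cong (_% suc t) (ℕP.+-comm (suc t) m)) ([m+n]%n≡m%n m (suc t))) ⟩
    G m ℤ.- G m
      ≡⟨ ℤP.+-inverseʳ (G m) ⟩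
    0ℤ
      ∎
    where open ≡-Reasoning
  coeff : ∀ n → (G ⊖ mon (suc t) ⊛ G) n ≡ onePS n
  coeff n with n ℕ.<? suc t
  ... | yes n<t+1 = trans (cong (λ x → G n ℤ.- x) (mon-⊛-coeff-< (suc t) G n n<t+1))
                      (trans (ℤP.+-identityʳ (G n)) (geom-below n (m<n⇒m%n≡m n<t+1)))
  ... | no n≮t+1  = subst (λ z → (G ⊖ mon (suc t) ⊛ G) z ≡ onePS z)
                      (ℕP.m+[n∸m]≡n (ℕP.≮⇒≥ n≮t+1)) (coeff-above (n ∸ suc t))

-- Gaussian binomial coefficients and the q-Pascal rules

prodPS-∷ʳ : ∀ xs x → prodPS (xs ∷ʳ x) ≋ prodPS xs ⊛ x
prodPS-∷ʳ []       x = ≋-trans (⊛-comm x onePS) (≋-trans (⊛-identityˡ x) (≋-sym (⊛-identityˡ x)))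
prodPS-∷ʳ (y ∷ xs) x = ≋-trans (⊛-congˡ y (prodPS-∷ʳ xs x)) (≋-sym (⊛-assoc y (prodPS xs) x))

prodPS-map-upTo-suc : ∀ (h : ℕ → PS) m → prodPS (map h (upTo (suc m))) ≋ prodPS (map h (upTo m)) ⊛ h m
prodPS-map-upTo-suc h m = ≋-trans
  (λ n → cong (λ xs → prodPS xs n) (trans (cong (map h) (sym (upTo-∷ʳ m))) (map-++ h (upTo m) (m ∷ []))))
  (prodPS-∷ʳ (map h (upTo m)) (h m))

poch-suc : ∀ m → poch (suc m) ≋ poch m ⊛ (onePS ⊖ mon (suc m))
poch-suc = prodPS-map-upTo-suc (λ i → onePS ⊖ mon (suc i))

invPoch-suc : ∀ m → invPoch (suc m) ≋ invPoch m ⊛ geom m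
invPoch-suc = prodPS-map-upTo-suc geom

poch-inverse : ∀ m → poch m ⊛ invPoch m ≋ onePS
poch-inverse zero    = ⊛-identityˡ onePS
poch-inverse (suc m) = begin
  poch (suc m) ⊛ invPoch (suc m)
    ≈⟨ ⊛-cong (poch-suc m) (invPoch-suc m) ⟩
  (poch m ⊛ (onePS ⊖ mon (suc m))) ⊛ (invPoch m ⊛ geom m)
    ≈⟨ solve 4 (λ a b c d → (a :* b) :* (c :* d) := (a :* c) :* (d :* b)) ≋-refl (poch m) (onePS ⊖ mon (suc m)) (invPoch m) (geom m) ⟩
  (poch m ⊛ invPoch m) ⊛ (geom m ⊛ (onePS ⊖ mon (suc m)))
    ≈⟨ ⊛-cong (poch-inverse m) (geom-inverse m) ⟩
  onePS ⊛ onePS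
    ≈⟨ ⊛-identityˡ onePS ⟩
  onePS
    ∎
  where open ≋-Reasoning

invPoch-≡ : ∀ {a b} → a ≡ b → invPoch a ≋ invPoch b
invPoch-≡ refl = ≋-refl

gauss-≤ : ∀ n k → k ≤ n → gauss n k ≋ poch n ⊛ invPoch k ⊛ invPoch (n ∸ k)
gauss-≤ n k k≤n with k ≤? n
... | yes _   = ≋-refl
... | no k≰n = ⊥-elim (k≰n k≤n)

gauss-> : ∀ n k → n < k → gauss n k ≋ zeroPS
gauss-> n k n<k with k ≤? n
... | yes k≤n = ⊥-elim (ℕP.<⇒≱ n<k k≤n)
... | no _    = ≋-refl

gauss-zero : ∀ n → gauss n 0 ≋ onePS
gauss-zero n = begin
  gauss n 0                          ≈⟨ gauss-≤ n 0 z≤n ⟩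
  poch n ⊛ onePS ⊛ invPoch n         ≈⟨ solve 2 (λ a b → a :* con 1ℤ :* b := a :* b) ≋-refl (poch n) (invPoch n) ⟩
  poch n ⊛ invPoch n                 ≈⟨ poch-inverse n ⟩
  onePS                              ∎
  where open ≋-Reasoning

gauss-diag : ∀ n → gauss n n ≋ onePS
gauss-diag n = begin
  gauss n n                             ≈⟨ gauss-≤ n n ℕP.≤-refl ⟩
  poch n ⊛ invPoch n ⊛ invPoch (n ∸ n)  ≈⟨ ⊛-congˡ (poch n ⊛ invPoch n) (invPoch-≡ (ℕP.n∸n≡0 n)) ⟩
  poch n ⊛ invPoch n ⊛ onePS            ≈⟨ ⊛-congʳ onePS (poch-inverse n) ⟩
  onePS ⊛ onePS                         ≈⟨ ⊛-identityˡ onePS ⟩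
  onePS                                 ∎
  where open ≋-Reasoning

gauss-sym : ∀ {n k} → k ≤ n → gauss n k ≋ gauss n (n ∸ k)
gauss-sym {n} {k} k≤n = begin
  gauss n k                                        ≈⟨ gauss-≤ n k k≤n ⟩
  poch n ⊛ invPoch k ⊛ invPoch (n ∸ k)             ≈⟨ solve 3 (λ a b c → a :* b :* c := a :* c :* b) ≋-refl (poch n) (invPoch k) (invPoch (n ∸ k)) ⟩
  poch n ⊛ invPoch (n ∸ k) ⊛ invPoch k             ≈⟨ ⊛-congˡ (poch n ⊛ invPoch (n ∸ k)) (invPoch-≡ (sym (ℕP.m∸[m∸n]≡n k≤n))) ⟩
  poch n ⊛ invPoch (n ∸ k) ⊛ invPoch (n ∸ (n ∸ k)) ≈⟨ ≋-sym (gauss-≤ n (n ∸ k) (ℕP.m∸n≤m n k)) ⟩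
  gauss n (n ∸ k)                                  ∎
  where open ≋-Reasoning

-- 1 - xy = (1 - x) + x (1 - y)
[1-xy]ab≈b+xa : ∀ a b x y → a ⊛ (onePS ⊖ x) ≋ onePS → b ⊛ (onePS ⊖ y) ≋ onePS →
                     (onePS ⊖ x ⊛ y) ⊛ (a ⊛ b) ≋ b ⊕ x ⊛ a
[1-xy]ab≈b+xa a b x y ax≈1 by≈1 = begin
  (onePS ⊖ x ⊛ y) ⊛ (a ⊛ b)
    ≈⟨ solve 4 (λ a b x y → (con 1ℤ :- x :* y) :* (a :* b) := b :* (a :* (con 1ℤ :- x)) :+ x :* a :* (b :* (con 1ℤ :- y))) ≋-refl a b x y ⟩
  b ⊛ (a ⊛ (onePS ⊖ x)) ⊕ x ⊛ a ⊛ (b ⊛ (onePS ⊖ y))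
    ≈⟨ ⊕-cong (⊛-congˡ b ax≈1) (⊛-congˡ (x ⊛ a) by≈1) ⟩
  b ⊛ onePS ⊕ x ⊛ a ⊛ onePS
    ≈⟨ solve 3 (λ a b x → b :* con 1ℤ :+ x :* a :* con 1ℤ := b :+ x :* a) ≋-refl a b x ⟩
  b ⊕ x ⊛ a
    ∎
  where open ≋-Reasoning

module Pascal (k r : ℕ) where
  private
    n : ℕ
    n = suc (k ℕ.+ r)
    P Ik Ir Gk Gr x y : PS
    P = poch n
    Ik = invPoch k
    Ir = invPoch r
    Gk = geom k
    Gr = geom r
    x = mon (suc k)
    y = mon (suc r)

    n∸k≡1+r : n ∸ k ≡ suc r
    n∸k≡1+r = trans (cong (_∸ k) (sym (ℕP.+-suc k r))) (ℕP.m+n∸m≡n k (suc r))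

    gauss-split : gauss (suc n) (suc k) ≋ (P ⊛ Ik ⊛ Ir) ⊛ ((onePS ⊖ x ⊛ y) ⊛ (Gk ⊛ Gr))
    gauss-split = begin
      gauss (suc n) (suc k)
        ≈⟨ gauss-≤ (suc n) (suc k) (s≤s (ℕP.m≤n⇒m≤1+n (ℕP.m≤m+n k r))) ⟩
      poch (suc n) ⊛ invPoch (suc k) ⊛ invPoch (n ∸ k)
        ≈⟨ ⊛-cong (⊛-cong (poch-suc n) (invPoch-suc k)) (≋-trans (invPoch-≡ n∸k≡1+r) (invPoch-suc r)) ⟩
      P ⊛ (onePS ⊖ mon (suc n)) ⊛ (Ik ⊛ Gk) ⊛ (Ir ⊛ Gr)
        ≈⟨ ⊛-congʳ (Ir ⊛ Gr) (⊛-congʳ (Ik ⊛ Gk) (⊛-congˡ P (+-congˡ {onePS} (-‿cong q^[n+1]≈xy)))) ⟩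
      P ⊛ (onePS ⊖ x ⊛ y) ⊛ (Ik ⊛ Gk) ⊛ (Ir ⊛ Gr)
        ≈⟨ solve 7 (λ P Ik Ir Gk Gr x y → P :* (con 1ℤ :- x :* y) :* (Ik :* Gk) :* (Ir :* Gr)
                                         := (P :* Ik :* Ir) :* ((con 1ℤ :- x :* y) :* (Gk :* Gr)))
                   ≋-refl P Ik Ir Gk Gr x y ⟩
      (P ⊛ Ik ⊛ Ir) ⊛ ((onePS ⊖ x ⊛ y) ⊛ (Gk ⊛ Gr))
        ∎
      where
      open ≋-Reasoning
      q^[n+1]≈xy : mon (suc n) ≋ x ⊛ y
      q^[n+1]≈xy = ≋-sym (≋-trans (mon-+ (suc k) (suc r)) (λ i → cong (λ e → mon (suc e) i) (ℕP.+-suc k r)))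

    gauss-n-k : gauss n k ≋ P ⊛ Ik ⊛ (Ir ⊛ Gr)
    gauss-n-k = ≋-trans (gauss-≤ n k (ℕP.m≤n⇒m≤1+n (ℕP.m≤m+n k r)))
                        (⊛-congˡ (P ⊛ Ik) (≋-trans (invPoch-≡ n∸k≡1+r) (invPoch-suc r)))

    gauss-n-1+k : gauss n (suc k) ≋ P ⊛ (Ik ⊛ Gk) ⊛ Ir
    gauss-n-1+k = ≋-trans (gauss-≤ n (suc k) (s≤s (ℕP.m≤m+n k r)))
                          (⊛-cong (⊛-congˡ P (invPoch-suc k)) (invPoch-≡ (ℕP.m+n∸m≡n k r)))

  pascal₂ : gauss (suc n) (suc k) ≋ gauss n k ⊕ mon (suc k) ⊛ gauss n (suc k)
  pascal₂ = begin
    gauss (suc n) (suc k)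
      ≈⟨ gauss-split ⟩
    (P ⊛ Ik ⊛ Ir) ⊛ ((onePS ⊖ x ⊛ y) ⊛ (Gk ⊛ Gr))
      ≈⟨ ⊛-congˡ (P ⊛ Ik ⊛ Ir) ([1-xy]ab≈b+xa Gk Gr x y (geom-inverse k) (geom-inverse r)) ⟩
    (P ⊛ Ik ⊛ Ir) ⊛ (Gr ⊕ x ⊛ Gk)
      ≈⟨ solve 6 (λ P Ik Ir Gk Gr x → (P :* Ik :* Ir) :* (Gr :+ x :* Gk)
                                    := P :* Ik :* (Ir :* Gr) :+ x :* (P :* (Ik :* Gk) :* Ir))
                 ≋-refl P Ik Ir Gk Gr x ⟩
    P ⊛ Ik ⊛ (Ir ⊛ Gr) ⊕ x ⊛ (P ⊛ (Ik ⊛ Gk) ⊛ Ir)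
      ≈⟨ ≋-sym (⊕-cong gauss-n-k (⊛-congˡ x gauss-n-1+k)) ⟩
    gauss n k ⊕ x ⊛ gauss n (suc k)
      ∎
    where open ≋-Reasoning

  pascal₁ : gauss (suc n) (suc k) ≋ gauss n (suc k) ⊕ mon (n ∸ k) ⊛ gauss n k
  pascal₁ = begin
    gauss (suc n) (suc k)
      ≈⟨ gauss-split ⟩
    (P ⊛ Ik ⊛ Ir) ⊛ ((onePS ⊖ x ⊛ y) ⊛ (Gk ⊛ Gr))
      ≈⟨ ⊛-congˡ (P ⊛ Ik ⊛ Ir) (solve 4 (λ x y Gk Gr → (con 1ℤ :- x :* y) :* (Gk :* Gr) := (con 1ℤ :- y :* x) :* (Gr :* Gk))
                                         ≋-refl x y Gk Gr) ⟩
    (P ⊛ Ik ⊛ Ir) ⊛ ((onePS ⊖ y ⊛ x) ⊛ (Gr ⊛ Gk))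
      ≈⟨ ⊛-congˡ (P ⊛ Ik ⊛ Ir) ([1-xy]ab≈b+xa Gr Gk y x (geom-inverse r) (geom-inverse k)) ⟩
    (P ⊛ Ik ⊛ Ir) ⊛ (Gk ⊕ y ⊛ Gr)
      ≈⟨ solve 6 (λ P Ik Ir Gk Gr y → (P :* Ik :* Ir) :* (Gk :+ y :* Gr)
                                    := P :* (Ik :* Gk) :* Ir :+ y :* (P :* Ik :* (Ir :* Gr)))
                 ≋-refl P Ik Ir Gk Gr y ⟩
    P ⊛ (Ik ⊛ Gk) ⊛ Ir ⊕ y ⊛ (P ⊛ Ik ⊛ (Ir ⊛ Gr))
      ≈⟨ ≋-sym (⊕-cong gauss-n-1+k (⊛-cong (λ i → cong (λ e → mon e i) n∸k≡1+r) gauss-n-k)) ⟩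
    gauss n (suc k) ⊕ mon (n ∸ k) ⊛ gauss n k
      ∎
    where open ≋-Reasoning

gauss-pascal₂ : ∀ n k → gauss (suc n) (suc k) ≋ gauss n k ⊕ mon (suc k) ⊛ gauss n (suc k)
gauss-pascal₂ n k with ℕP.<-cmp k n
... | tri< k<n _ _ = subst (λ n → gauss (suc n) (suc k) ≋ gauss n k ⊕ mon (suc k) ⊛ gauss n (suc k))
                           (ℕP.m+[n∸m]≡n k<n) (Pascal.pascal₂ k (n ∸ suc k))
... | tri≈ _ refl _ = ≋-trans (gauss-diag (suc n)) (≋-sym (≋-trans
                        (a+m*b≈a (gauss n n) (mon (suc n)) (gauss-> n (suc n) (ℕP.n<1+n n))) (gauss-diag n)))
... | tri> _ _ n<k = ≋-trans (gauss-> (suc n) (suc k) (s≤s n<k)) (≋-sym (≋-trans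
                        (a+m*b≈a (gauss n k) (mon (suc k)) (gauss-> n (suc k) (ℕP.m<n⇒m<1+n n<k))) (gauss-> n k n<k)))

gauss-pascal₁ : ∀ n k → gauss (suc n) (suc k) ≋ gauss n (suc k) ⊕ mon (n ∸ k) ⊛ gauss n k
gauss-pascal₁ n k with ℕP.<-cmp k n
... | tri< k<n _ _ = subst (λ n → gauss (suc n) (suc k) ≋ gauss n (suc k) ⊕ mon (n ∸ k) ⊛ gauss n k)
                           (ℕP.m+[n∸m]≡n k<n) (Pascal.pascal₁ k (n ∸ suc k))
... | tri≈ _ refl _ = begin
  gauss (suc n) (suc n)                         ≈⟨ gauss-diag (suc n) ⟩
  onePS                                         ≈⟨ ≋-sym (⊛-identityˡ onePS) ⟩
  onePS ⊛ onePS                                 ≈⟨ ≋-sym (⊛-cong q⁰≈1 (gauss-diag n)) ⟩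
  mon (n ∸ n) ⊛ gauss n n                       ≈⟨ ≋-sym (≋-trans (+-congʳ {mon (n ∸ n) ⊛ gauss n n} [n,1+n]≈0) (+-identityˡ _)) ⟩
  gauss n (suc n) ⊕ mon (n ∸ n) ⊛ gauss n n     ∎
  where
  open ≋-Reasoning
  q⁰≈1 : mon (n ∸ n) ≋ onePS
  q⁰≈1 = ≋-trans (λ i → cong (λ e → mon e i) (ℕP.n∸n≡0 n)) mon-zero
  [n,1+n]≈0 : gauss n (suc n) ≋ zeroPS
  [n,1+n]≈0 = gauss-> n (suc n) (ℕP.n<1+n n)
... | tri> _ _ n<k = ≋-trans (gauss-> (suc n) (suc k) (s≤s n<k)) (≋-sym (≋-trans
                        (a+m*b≈a (gauss n (suc k)) (mon (n ∸ k)) (gauss-> n k n<k)) (gauss-> n (suc k) (ℕP.m<n⇒m<1+n n<k))))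

+m-+k≡+[m∸k] : ∀ {m k} → k ≤ m → + m ℤ.- + k ≡ + (m ∸ k)
+m-+k≡+[m∸k] {m} {k} k≤m = trans (ℤP.m-n≡m⊖n m k) (ℤP.⊖-≥ k≤m)

gaussℤ-pascal₂ : ∀ n j → gaussℤ (suc n) j ≋ gaussℤ n (j ℤ.- 1ℤ) ⊕ mon ∣ j ∣ ⊛ gaussℤ n j
gaussℤ-pascal₂ n (+ zero)    = ≋-trans (gauss-zero (suc n)) (≋-sym (≋-trans (+-identityˡ _)
                                 (≋-trans (⊛-cong mon-zero (gauss-zero n)) (⊛-identityˡ onePS))))
gaussℤ-pascal₂ n (+ suc k)   = gauss-pascal₂ n k
gaussℤ-pascal₂ n -[1+ i ]    = ≋-sym (≋-trans (+-identityˡ _) (zeroʳ (mon (suc i))))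

gaussℤ-pascal₁ : ∀ n j → gaussℤ (suc n) j ≋ gaussℤ n j ⊕ mon ∣ + suc n ℤ.- j ∣ ⊛ gaussℤ n (j ℤ.- 1ℤ)
gaussℤ-pascal₁ n (+ zero)  = ≋-trans (gauss-zero (suc n))
                               (≋-sym (≋-trans (a+m*b≈a (gauss n 0) (mon ∣ + suc n ℤ.- + 0 ∣) ≋-refl) (gauss-zero n)))
gaussℤ-pascal₁ n (+ suc k) with ℕP.≤-<-connex k n
... | inj₁ k≤n = ≋-trans (gauss-pascal₁ n k)
                   (+-congˡ {gauss n (suc k)} (⊛-congʳ (gauss n k) (λ i → cong (λ e → mon ∣ e ∣ i) (sym (+m-+k≡+[m∸k] (s≤s k≤n))))))
... | inj₂ n<k = ≋-trans (gauss-> (suc n) (suc k) (s≤s n<k)) (≋-sym (≋-trans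
                   (a+m*b≈a (gauss n (suc k)) (mon ∣ + suc n ℤ.- + suc k ∣) (gauss-> n k n<k))
                   (gauss-> n (suc k) (ℕP.m<n⇒m<1+n n<k))))
gaussℤ-pascal₁ n -[1+ i ]  = ≋-sym (≋-trans (+-identityˡ _) (zeroʳ (mon ∣ + suc n ℤ.- -[1+ i ] ∣)))

gaussℤ-sym : ∀ n j → gaussℤ n j ≋ gaussℤ n (+ n ℤ.- j)
gaussℤ-sym n (+ k) with ℕP.≤-<-connex k n
... | inj₁ k≤n = ≋-trans (gauss-sym k≤n) (λ i → cong (λ e → gaussℤ n e i) (sym (+m-+k≡+[m∸k] k≤n)))
... | inj₂ n<k = ≋-trans (gauss-> n k n<k) (λ i → cong (λ e → gaussℤ n e i) (sym +n-+k≡-[1+k∸1+n]))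
  where
  +n-+k≡-[1+k∸1+n] : + n ℤ.- + k ≡ -[1+ k ∸ suc n ]
  +n-+k≡-[1+k∸1+n] = trans (ℤP.m-n≡m⊖n n k) (trans (ℤP.⊖-< n<k) (cong (λ e → ℤ.- + e) (ℕP.+-∸-assoc 1 n<k)))
gaussℤ-sym n -[1+ i ] = ≋-sym (gauss-> n (n ℕ.+ suc i) (ℕP.m<m+n n (s≤s z≤n)))

gaussℤ-below : ∀ T s {k} → k ≡ ℤ.- (1ℤ ℤ.+ + s) → gaussℤ T k ≋ zeroPS
gaussℤ-below T s refl = ≋-refl

gaussℤ-above : ∀ T s {k} → k ≡ + T ℤ.+ (1ℤ ℤ.+ + s) → gaussℤ T k ≋ zeroPS
gaussℤ-above T s refl = gauss-> T (T ℕ.+ suc s) (ℕP.m<m+n T (ℕ.s≤s z≤n))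

-- Sums over a symmetric range

symSum : (ℤ → PS) → ℕ → PS
symSum f zero    = f (+ 0)
symSum f (suc N) = symSum f N ⊕ f (+ suc N) ⊕ f -[1+ N ]

symSum-cong : ∀ {f g} N → (∀ j → f j ≋ g j) → symSum f N ≋ symSum g N
symSum-cong zero    p = p (+ 0)
symSum-cong (suc N) p = ⊕-cong (⊕-cong (symSum-cong N p) (p (+ suc N))) (p -[1+ N ])

symSum-⊕ : ∀ f g N → symSum (λ j → f j ⊕ g j) N ≋ symSum f N ⊕ symSum g N
symSum-⊕ f g zero    = ≋-refl
symSum-⊕ f g (suc N) = ≋-trans (⊕-cong (⊕-cong (symSum-⊕ f g N) ≋-refl) ≋-refl)
  (solve 6 (λ a b c d e h → a :+ b :+ (c :+ d) :+ (e :+ h) := a :+ c :+ e :+ (b :+ d :+ h)) ≋-refl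
     (symSum f N) (symSum g N) (f (+ suc N)) (g (+ suc N)) (f -[1+ N ]) (g -[1+ N ]))

symSum-scale : ∀ c f N → symSum (λ j → c ⊛ f j) N ≋ c ⊛ symSum f N
symSum-scale c f zero    = ≋-refl
symSum-scale c f (suc N) = ≋-trans (⊕-cong (⊕-cong (symSum-scale c f N) ≋-refl) ≋-refl)
  (solve 4 (λ c a b d → c :* a :+ c :* b :+ c :* d := c :* (a :+ b :+ d)) ≋-refl
     c (symSum f N) (f (+ suc N)) (f -[1+ N ]))

symSum-neg : ∀ f N → symSum (λ j → negPS (f j)) N ≋ negPS (symSum f N)
symSum-neg f zero    = ≋-refl
symSum-neg f (suc N) = ≋-trans (⊕-cong (⊕-cong (symSum-neg f N) ≋-refl) ≋-refl)
  (solve 3 (λ a b d → (:- a) :+ (:- b) :+ (:- d) := :- (a :+ b :+ d)) ≋-refl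
     (symSum f N) (f (+ suc N)) (f -[1+ N ]))

symSum-reflect : ∀ f N → symSum (λ j → f (ℤ.- j)) N ≋ symSum f N
symSum-reflect f zero    = ≋-refl
symSum-reflect f (suc N) = ≋-trans (⊕-cong (⊕-cong (symSum-reflect f N) ≋-refl) ≋-refl)
  (solve 3 (λ a b d → a :+ b :+ d := a :+ d :+ b) ≋-refl (symSum f N) (f -[1+ N ]) (f (+ suc N)))

symSum-shift : ∀ f N → symSum (λ j → f (1ℤ ℤ.+ j)) N ⊕ f (ℤ.- + N) ≋ symSum f N ⊕ f (+ suc N)
symSum-shift f zero    = +-comm (f 1ℤ) (f (+ 0))
symSum-shift f (suc N) = begin
  S′ N ⊕ f (+ 2 ℤ.+ + N) ⊕ f (1ℤ ℤ.+ -[1+ N ]) ⊕ f -[1+ N ]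
    ≈⟨ +-congʳ {f -[1+ N ]} (+-congˡ {S′ N ⊕ f (+ 2 ℤ.+ + N)} (λ i → cong (λ j → f j i) (1+-[1+N]≡-N N))) ⟩
  S′ N ⊕ f (+ 2 ℤ.+ + N) ⊕ f (ℤ.- + N) ⊕ f -[1+ N ]
    ≈⟨ solve 4 (λ a b c d → a :+ b :+ c :+ d := (a :+ c) :+ b :+ d) ≋-refl
         (S′ N) (f (+ 2 ℤ.+ + N)) (f (ℤ.- + N)) (f -[1+ N ]) ⟩
  (S′ N ⊕ f (ℤ.- + N)) ⊕ f (+ 2 ℤ.+ + N) ⊕ f -[1+ N ]
    ≈⟨ +-congʳ {f -[1+ N ]} (+-congʳ {f (+ 2 ℤ.+ + N)} (symSum-shift f N)) ⟩
  symSum f N ⊕ f (+ suc N) ⊕ f (+ 2 ℤ.+ + N) ⊕ f -[1+ N ]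
    ≈⟨ solve 4 (λ a b c d → a :+ b :+ c :+ d := a :+ b :+ d :+ c) ≋-refl
         (symSum f N) (f (+ suc N)) (f (+ 2 ℤ.+ + N)) (f -[1+ N ]) ⟩
  symSum f (suc N) ⊕ f (+ suc (suc N))
    ∎
  where
  open ≋-Reasoning
  S′ : ℕ → PS
  S′ = symSum (λ j → f (1ℤ ℤ.+ j))
  1+-[1+N]≡-N : ∀ N → 1ℤ ℤ.+ -[1+ N ] ≡ ℤ.- + N
  1+-[1+N]≡-N zero    = refl
  1+-[1+N]≡-N (suc N) = refl

symSum-shift-vanishing : ∀ f N → f (ℤ.- + N) ≋ zeroPS → f (+ suc N) ≋ zeroPS →
                         symSum f N ≋ symSum (λ j → f (1ℤ ℤ.+ j)) N
symSum-shift-vanishing f N f[-N]≈0 f[N+1]≈0 = begin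
  symSum f N                                      ≈⟨ ≋-sym (a+b≈a (symSum f N) f[N+1]≈0) ⟩
  symSum f N ⊕ f (+ suc N)                         ≈⟨ ≋-sym (symSum-shift f N) ⟩
  symSum (λ j → f (1ℤ ℤ.+ j)) N ⊕ f (ℤ.- + N)       ≈⟨ a+b≈a _ f[-N]≈0 ⟩
  symSum (λ j → f (1ℤ ℤ.+ j)) N                    ∎
  where open ≋-Reasoning

symSum-extend-vanishing : ∀ f N → f (+ suc N) ≋ zeroPS → f -[1+ N ] ≋ zeroPS → symSum f (suc N) ≋ symSum f N
symSum-extend-vanishing f N f[N+1]≈0 f[-N-1]≈0 =
  ≋-trans (a+b≈a _ f[-N-1]≈0) (a+b≈a _ f[N+1]≈0)

-- Sums of weighted Gaussian binomials

half : ℤ → ℕ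
half x = ∣ x ∣ ℕ./ 2

half-+2* : ∀ a b → half (+ a ℤ.+ + 2 ℤ.* + b) ≡ half (+ a) ℕ.+ b
half-+2* a b = begin
  ∣ + a ℤ.+ + 2 ℤ.* + b ∣ ℕ./ 2   ≡⟨ cong (λ x → ∣ + a ℤ.+ x ∣ ℕ./ 2) (sym (ℤP.pos-* 2 b)) ⟩
  (a ℕ.+ 2 ℕ.* b) ℕ./ 2           ≡⟨ +-distrib-/-∣ʳ a (divides b (ℕP.*-comm 2 b)) ⟩
  a ℕ./ 2 ℕ.+ 2 ℕ.* b ℕ./ 2       ≡⟨ cong (λ x → a ℕ./ 2 ℕ.+ x ℕ./ 2) (ℕP.*-comm 2 b) ⟩
  a ℕ./ 2 ℕ.+ b ℕ.* 2 ℕ./ 2       ≡⟨ cong (a ℕ./ 2 ℕ.+_) (m*n/n≡m b 2) ⟩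
  a ℕ./ 2 ℕ.+ b                   ∎
  where open ≡-Reasoning

-- c q^(e/2) [T, k]; exponents are carried doubled so that they stay integer polynomials in the summation index
term : ℤ → ℤ → ℕ → ℤ → PS
term c e T k = const c ⊛ mon (half e) ⊛ gaussℤ T k

term-vanishing : ∀ c e T k → gaussℤ T k ≋ zeroPS → term c e T k ≋ zeroPS
term-vanishing c e T k = ⊛-vanishingʳ (const c ⊛ mon (half e))

term-raise : ∀ c e T k d → (0ℤ ℤ.≤ k → 0ℤ ℤ.≤ e) → (0ℤ ℤ.≤ k → k ℤ.≤ + T → 0ℤ ℤ.≤ d) →
             term c (e ℤ.+ + 2 ℤ.* d) T k ≋ mon ∣ d ∣ ⊛ term c e T k
term-raise c e T -[1+ i ] d _ _ =
  ≋-trans (term-vanishing c (e ℤ.+ + 2 ℤ.* d) T -[1+ i ] ≋-refl) (≋-sym (⊛-vanishingʳ (mon ∣ d ∣) (term-vanishing c e T -[1+ i ] ≋-refl)))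
term-raise c e T (+ k) d 0≤e 0≤d with ℕP.≤-<-connex k T
term-raise c e T (+ k) d 0≤e 0≤d | inj₂ T<k =
  ≋-trans (term-vanishing c (e ℤ.+ + 2 ℤ.* d) T (+ k) G≈0) (≋-sym (⊛-vanishingʳ (mon ∣ d ∣) (term-vanishing c e T (+ k) G≈0)))
  where
  G≈0 : gauss T k ≋ zeroPS
  G≈0 = gauss-> T k T<k
term-raise c e T (+ k) d 0≤e 0≤d | inj₁ k≤T with 0≤e (+≤+ z≤n) | 0≤d (+≤+ z≤n) (+≤+ k≤T)
... | +≤+ {n = a} _ | +≤+ {n = b} _ = begin
  const c ⊛ mon (half (+ a ℤ.+ + 2 ℤ.* + b)) ⊛ G   ≈⟨ ⊛-congʳ G (⊛-congˡ (const c) (λ i → cong (λ x → mon x i) (half-+2* a b))) ⟩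
  const c ⊛ mon (half (+ a) ℕ.+ b) ⊛ G             ≈⟨ ⊛-congʳ G (⊛-congˡ (const c) (≋-sym (mon-+ (half (+ a)) b))) ⟩
  const c ⊛ (mon (half (+ a)) ⊛ mon b) ⊛ G         ≈⟨ solve 4 (λ C A B G → C :* (A :* B) :* G := B :* (C :* A :* G)) ≋-refl
                                                             (const c) (mon (half (+ a))) (mon b) G ⟩
  mon b ⊛ (const c ⊛ mon (half (+ a)) ⊛ G)         ∎
  where
  open ≋-Reasoning
  G : PS
  G = gauss T k

term-pascal₂ : ∀ c e T k → (0ℤ ℤ.≤ k → 0ℤ ℤ.≤ e) →
               term c e (suc T) k ≋ term c e T (k ℤ.- 1ℤ) ⊕ term c (e ℤ.+ + 2 ℤ.* k) T k
term-pascal₂ c e T k 0≤e = begin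
  const c ⊛ mon (half e) ⊛ gaussℤ (suc T) k
    ≈⟨ ⊛-congˡ (const c ⊛ mon (half e)) (gaussℤ-pascal₂ T k) ⟩
  const c ⊛ mon (half e) ⊛ (gaussℤ T (k ℤ.- 1ℤ) ⊕ mon ∣ k ∣ ⊛ gaussℤ T k)
    ≈⟨ solve 4 (λ A B M G → A :* (B :+ M :* G) := A :* B :+ M :* (A :* G)) ≋-refl
         (const c ⊛ mon (half e)) (gaussℤ T (k ℤ.- 1ℤ)) (mon ∣ k ∣) (gaussℤ T k) ⟩
  term c e T (k ℤ.- 1ℤ) ⊕ mon ∣ k ∣ ⊛ term c e T k
    ≈⟨ +-congˡ {term c e T (k ℤ.- 1ℤ)} (≋-sym (term-raise c e T k k 0≤e (λ 0≤k _ → 0≤k))) ⟩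
  term c e T (k ℤ.- 1ℤ) ⊕ term c (e ℤ.+ + 2 ℤ.* k) T k
    ∎
  where open ≋-Reasoning

term-pascal₁ : ∀ c e T k → (0ℤ ℤ.≤ k → 0ℤ ℤ.≤ e) →
               term c e (suc T) k ≋ term c e T k ⊕ term c (e ℤ.+ + 2 ℤ.* (+ suc T ℤ.- k)) T (k ℤ.- 1ℤ)
term-pascal₁ c e T k 0≤e = begin
  const c ⊛ mon (half e) ⊛ gaussℤ (suc T) k
    ≈⟨ ⊛-congˡ (const c ⊛ mon (half e)) (gaussℤ-pascal₁ T k) ⟩
  const c ⊛ mon (half e) ⊛ (gaussℤ T k ⊕ mon ∣ d ∣ ⊛ gaussℤ T (k ℤ.- 1ℤ))
    ≈⟨ solve 4 (λ A B M G → A :* (B :+ M :* G) := A :* B :+ M :* (A :* G)) ≋-refl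
         (const c ⊛ mon (half e)) (gaussℤ T k) (mon ∣ d ∣) (gaussℤ T (k ℤ.- 1ℤ)) ⟩
  term c e T k ⊕ mon ∣ d ∣ ⊛ term c e T (k ℤ.- 1ℤ)
    ≈⟨ +-congˡ {term c e T k} (≋-sym (term-raise c e T (k ℤ.- 1ℤ) d 0≤e′ 0≤d)) ⟩
  term c e T k ⊕ term c (e ℤ.+ + 2 ℤ.* d) T (k ℤ.- 1ℤ)
    ∎
  where
  open ≋-Reasoning
  d : ℤ
  d = + suc T ℤ.- k
  0≤e′ : 0ℤ ℤ.≤ k ℤ.- 1ℤ → 0ℤ ℤ.≤ e
  0≤e′ 0≤k-1 = 0≤e (ℤP.≤-trans 0≤k-1 (ℤP.i-j≤i k 1ℤ))
  0≤d : 0ℤ ℤ.≤ k ℤ.- 1ℤ → k ℤ.- 1ℤ ℤ.≤ + T → 0ℤ ℤ.≤ d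
  0≤d _ k-1≤T = subst (0ℤ ℤ.≤_) (T-[k-1]≡1+T-k (+ T) k) (ℤP.i≤j⇒0≤j-i k-1≤T)
    where
    T-[k-1]≡1+T-k : ∀ T k → T ℤ.- (k ℤ.- 1ℤ) ≡ 1ℤ ℤ.+ T ℤ.- k
    T-[k-1]≡1+T-k = solve-∀

termSum : (ℤ → ℤ) → (ℤ → ℤ) → ℕ → (ℤ → ℤ) → ℕ → PS
termSum g e T k N = symSum (λ j → term (g j) (e j) T (k j)) N

ExponentNonneg : (ℤ → ℤ) → (ℤ → ℤ) → Set
ExponentNonneg e k = ∀ j → 0ℤ ℤ.≤ k j → 0ℤ ℤ.≤ e j

termSum-cong : ∀ {g g′ e e′ k k′} T N → (∀ j → g j ≡ g′ j) → (∀ j → e j ≡ e′ j) → (∀ j → k j ≡ k′ j) →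
            termSum g e T k N ≋ termSum g′ e′ T k′ N
termSum-cong T N g≡g′ e≡e′ k≡k′ = symSum-cong N (λ j → term-≡ (g≡g′ j) (e≡e′ j) (k≡k′ j))
  where
  term-≡ : ∀ {c c′ e e′ k k′} → c ≡ c′ → e ≡ e′ → k ≡ k′ → term c e T k ≋ term c′ e′ T k′
  term-≡ refl refl refl = ≋-refl

termSum-pascal₂ : ∀ g e T k N → ExponentNonneg e k →
               termSum g e (suc T) k N ≋ termSum g e T (λ j → k j ℤ.- 1ℤ) N ⊕ termSum g (λ j → e j ℤ.+ + 2 ℤ.* k j) T k N
termSum-pascal₂ g e T k N e≥0 = ≋-trans (symSum-cong N (λ j → term-pascal₂ (g j) (e j) T (k j) (e≥0 j))) (symSum-⊕ _ _ N)

termSum-pascal₁ : ∀ g e T k N → ExponentNonneg e k →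
               termSum g e (suc T) k N ≋ termSum g e T k N ⊕ termSum g (λ j → e j ℤ.+ + 2 ℤ.* (+ suc T ℤ.- k j)) T (λ j → k j ℤ.- 1ℤ) N
termSum-pascal₁ g e T k N e≥0 = ≋-trans (symSum-cong N (λ j → term-pascal₁ (g j) (e j) T (k j) (e≥0 j))) (symSum-⊕ _ _ N)

termSum-raise : ∀ g e T k a N → ExponentNonneg e k → termSum g (λ j → e j ℤ.+ + 2 ℤ.* + a) T k N ≋ mon a ⊛ termSum g e T k N
termSum-raise g e T k a N e≥0 =
  ≋-trans (symSum-cong N (λ j → term-raise (g j) (e j) T (k j) (+ a) (e≥0 j) (λ _ _ → +≤+ z≤n))) (symSum-scale (mon a) _ N)

termSum-reflect : ∀ g e T k N → termSum g e T k N ≋ termSum (λ j → g (ℤ.- j)) (λ j → e (ℤ.- j)) T (λ j → + T ℤ.- k (ℤ.- j)) N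
termSum-reflect g e T k N = ≋-trans (≋-sym (symSum-reflect _ N))
  (symSum-cong N (λ j → ⊛-congˡ (const (g (ℤ.- j)) ⊛ mon (half (e (ℤ.- j)))) (gaussℤ-sym T (k (ℤ.- j)))))

termSum-shift : ∀ g e T k N → gaussℤ T (k (ℤ.- + N)) ≋ zeroPS → gaussℤ T (k (+ suc N)) ≋ zeroPS →
             termSum g e T k N ≋ termSum (λ j → g (1ℤ ℤ.+ j)) (λ j → e (1ℤ ℤ.+ j)) T (λ j → k (1ℤ ℤ.+ j)) N
termSum-shift g e T k N G₋≈0 G₊≈0 = symSum-shift-vanishing (λ j → term (g j) (e j) T (k j)) N
  (term-vanishing (g (ℤ.- + N)) (e (ℤ.- + N)) T (k (ℤ.- + N)) G₋≈0)
  (term-vanishing (g (+ suc N)) (e (+ suc N)) T (k (+ suc N)) G₊≈0)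

termSum-extend : ∀ g e T k N → gaussℤ T (k (+ suc N)) ≋ zeroPS → gaussℤ T (k -[1+ N ]) ≋ zeroPS →
              termSum g e T k (suc N) ≋ termSum g e T k N
termSum-extend g e T k N G₊≈0 G₋≈0 = symSum-extend-vanishing (λ j → term (g j) (e j) T (k j)) N
  (term-vanishing (g (+ suc N)) (e (+ suc N)) T (k (+ suc N)) G₊≈0)
  (term-vanishing (g -[1+ N ]) (e -[1+ N ]) T (k -[1+ N ]) G₋≈0)

termSum-negate : ∀ g e T k N → termSum (λ j → ℤ.- g j) e T k N ≋ negPS (termSum g e T k N)
termSum-negate g e T k N = ≋-trans (symSum-cong N negate-term) (symSum-neg _ N)
  where
  negate-term : ∀ j → term (ℤ.- g j) (e j) T (k j) ≋ negPS (term (g j) (e j) T (k j))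
  negate-term j = ≋-trans (⊛-congʳ (gaussℤ T (k j)) (⊛-congʳ (mon (half (e j))) const-neg))
    (solve 3 (λ C M G → (:- C) :* M :* G := :- (C :* M :* G)) ≋-refl (const (g j)) (mon (half (e j))) (gaussℤ T (k j)))
    where
    const-neg : const (ℤ.- g j) ≋ negPS (const (g j))
    const-neg zero    = refl
    const-neg (suc n) = refl

-- The sums D

sign : ℤ → ℤ
sign j = -1ℤ ℤ.^ ∣ j ∣

sign-neg : ∀ j → sign (ℤ.- j) ≡ sign j
sign-neg j = cong (-1ℤ ℤ.^_) (ℤP.∣-i∣≡∣i∣ j)

sign-suc : ∀ j → sign (1ℤ ℤ.+ j) ≡ ℤ.- sign j
sign-suc (+ n)           = ℤP.-1*i≡-i (sign (+ n))
sign-suc -[1+ zero ]     = refl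
sign-suc -[1+ suc n ]    = sym (trans (cong ℤ.-_ (ℤP.-1*i≡-i (sign -[1+ n ]))) (ℤP.neg-involutive _))

0≤[1+a][b+5a]+c : ∀ {x} a b c → x ≡ (1ℤ ℤ.+ + a) ℤ.* (+ b ℤ.+ + 5 ℤ.* + a) ℤ.+ + c → 0ℤ ℤ.≤ x
0≤[1+a][b+5a]+c a b c refl = subst (0ℤ ℤ.≤_) (sym is-nat) (+≤+ z≤n)
  where
  is-nat : (1ℤ ℤ.+ + a) ℤ.* (+ b ℤ.+ + 5 ℤ.* + a) ℤ.+ + c ≡ + (suc a ℕ.* (b ℕ.+ 5 ℕ.* a) ℕ.+ c)
  is-nat = cong (ℤ._+ + c) (trans (cong (λ y → + suc a ℤ.* (+ b ℤ.+ y)) (sym (ℤP.pos-* 5 a)))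
                                  (sym (ℤP.pos-* (suc a) (b ℕ.+ 5 ℕ.* a))))

e₀ : ℤ → ℤ
e₀ j = j ℤ.* (+ 5 ℤ.* j ℤ.- + 3)

e₁ : ℤ → ℤ
e₁ j = j ℤ.* (+ 5 ℤ.* j ℤ.- + 1)

e₀-nonneg : ∀ j → 0ℤ ℤ.≤ e₀ j
e₀-nonneg (+ zero)  = +≤+ z≤n
e₀-nonneg (+ suc a) = 0≤[1+a][b+5a]+c a 2 0 (eq (+ a))
  where
  eq : ∀ A → (1ℤ ℤ.+ A) ℤ.* (+ 5 ℤ.* (1ℤ ℤ.+ A) ℤ.- + 3) ≡ (1ℤ ℤ.+ A) ℤ.* (+ 2 ℤ.+ + 5 ℤ.* A) ℤ.+ 0ℤ
  eq = solve-∀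
e₀-nonneg -[1+ a ]  = 0≤[1+a][b+5a]+c a 8 0 (eq (+ a))
  where
  eq : ∀ A → ℤ.- (1ℤ ℤ.+ A) ℤ.* (+ 5 ℤ.* ℤ.- (1ℤ ℤ.+ A) ℤ.- + 3) ≡ (1ℤ ℤ.+ A) ℤ.* (+ 8 ℤ.+ + 5 ℤ.* A) ℤ.+ 0ℤ
  eq = solve-∀

e₁-nonneg : ∀ j → 0ℤ ℤ.≤ e₁ j
e₁-nonneg (+ zero)  = +≤+ z≤n
e₁-nonneg (+ suc a) = 0≤[1+a][b+5a]+c a 4 0 (eq (+ a))
  where
  eq : ∀ A → (1ℤ ℤ.+ A) ℤ.* (+ 5 ℤ.* (1ℤ ℤ.+ A) ℤ.- + 1) ≡ (1ℤ ℤ.+ A) ℤ.* (+ 4 ℤ.+ + 5 ℤ.* A) ℤ.+ 0ℤ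
  eq = solve-∀
e₁-nonneg -[1+ a ]  = 0≤[1+a][b+5a]+c a 6 0 (eq (+ a))
  where
  eq : ∀ A → ℤ.- (1ℤ ℤ.+ A) ℤ.* (+ 5 ℤ.* ℤ.- (1ℤ ℤ.+ A) ℤ.- + 1) ≡ (1ℤ ℤ.+ A) ℤ.* (+ 6 ℤ.+ + 5 ℤ.* A) ℤ.+ 0ℤ
  eq = solve-∀

κ : ℕ → ℤ → ℤ
κ m j = + suc m ℤ.- + 2 ℤ.* j

dSum : (ℤ → ℤ) → ℕ → ℕ → PS
dSum e m N = termSum sign e (suc (2 ℕ.* m)) (κ m) N

-- j ↦ 1 - j flips the sign (-1)^j
termSum-sign-reflect : ∀ e T k N → gaussℤ T (k (ℤ.- + N)) ≋ zeroPS → gaussℤ T (k (+ suc N)) ≋ zeroPS →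
  termSum sign e T k N ≋ negPS (termSum sign (λ j → e (1ℤ ℤ.+ ℤ.- j)) T (λ j → + T ℤ.- k (1ℤ ℤ.+ ℤ.- j)) N)
termSum-sign-reflect e T k N G₋≈0 G₊≈0 = begin
  termSum sign e T k N
    ≈⟨ termSum-shift sign e T k N G₋≈0 G₊≈0 ⟩
  termSum (λ j → sign (1ℤ ℤ.+ j)) (λ j → e (1ℤ ℤ.+ j)) T (λ j → k (1ℤ ℤ.+ j)) N
    ≈⟨ termSum-reflect (λ j → sign (1ℤ ℤ.+ j)) (λ j → e (1ℤ ℤ.+ j)) T (λ j → k (1ℤ ℤ.+ j)) N ⟩
  termSum (λ j → sign (1ℤ ℤ.+ ℤ.- j)) e′ T k′ N
    ≈⟨ termSum-cong {e = e′} {k = k′} T N (λ j → trans (sign-suc (ℤ.- j)) (cong ℤ.-_ (sign-neg j))) (λ _ → refl) (λ _ → refl) ⟩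
  termSum (λ j → ℤ.- sign j) e′ T k′ N
    ≈⟨ termSum-negate sign e′ T k′ N ⟩
  negPS (termSum sign e′ T k′ N)
    ∎
  where
  open ≋-Reasoning
  e′ k′ : ℤ → ℤ
  e′ j = e (1ℤ ℤ.+ ℤ.- j)
  k′ j = + T ℤ.- k (1ℤ ℤ.+ ℤ.- j)

-- The ℤ identities below are proved for a variable M and instantiated at M = + m, so their left-hand sides
-- are written to unfold to the goals; e.g. + (2 * m) appears as M ℤ.+ (M ℤ.+ 0ℤ).
module DSumRecurrence (m N : ℕ) (m<N : m ℕ.< N) where
  private
    s : ℕ
    s = proj₁ (ℕP.m≤n⇒∃[o]m+o≡n m<N)
    1+m+s≡N : suc m ℕ.+ s ≡ N
    1+m+s≡N = proj₂ (ℕP.m≤n⇒∃[o]m+o≡n m<N)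
    T : ℕ
    T = suc (2 ℕ.* m)
    M S : ℤ
    M = + m
    S = + s
    x : PS
    x = mon (suc m)
    κ′ : ℤ → ℤ
    κ′ = κ (suc m)

    T′≡2+T : suc (2 ℕ.* suc m) ≡ suc (suc T)
    T′≡2+T = cong suc (ℕP.*-suc 2 m)

    dSum-at-suc : ∀ e → dSum e (suc m) N ≋ termSum sign e (suc (suc T)) κ′ N
    dSum-at-suc e i = cong (λ T′ → termSum sign e T′ κ′ N i) T′≡2+T

    κ′-1≡κ : ∀ j → κ′ j ℤ.- 1ℤ ≡ κ m j
    κ′-1≡κ j = eq M j
      where
      eq : ∀ M j → 1ℤ ℤ.+ (1ℤ ℤ.+ M) ℤ.- + 2 ℤ.* j ℤ.- 1ℤ ≡ 1ℤ ℤ.+ M ℤ.- + 2 ℤ.* j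
      eq = solve-∀

    κ-reflect : ∀ j → + T ℤ.- (κ m (ℤ.- j) ℤ.- 1ℤ) ≡ κ m j
    κ-reflect j = eq M j
      where
      eq : ∀ M j → 1ℤ ℤ.+ (M ℤ.+ (M ℤ.+ 0ℤ)) ℤ.- (1ℤ ℤ.+ M ℤ.- + 2 ℤ.* ℤ.- j ℤ.- 1ℤ) ≡ 1ℤ ℤ.+ M ℤ.- + 2 ℤ.* j
      eq = solve-∀

    pascal-reflect : ∀ e e′ → (∀ j → e (ℤ.- j) ℤ.+ + 2 ℤ.* (+ suc T ℤ.- κ m (ℤ.- j)) ≡ e′ j ℤ.+ + 2 ℤ.* + suc m) →
                     (∀ j → 0ℤ ℤ.≤ e j) → (∀ j → 0ℤ ℤ.≤ e′ j) →
                     termSum sign e (suc T) (κ m) N ≋ dSum e m N ⊕ x ⊛ dSum e′ m N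
    pascal-reflect e e′ e-eq e≥0 e′≥0 = begin
      termSum sign e (suc T) (κ m) N
        ≈⟨ termSum-pascal₁ sign e T (κ m) N (λ j _ → e≥0 j) ⟩
      dSum e m N ⊕ termSum sign (λ j → e j ℤ.+ + 2 ℤ.* (+ suc T ℤ.- κ m j)) T (λ j → κ m j ℤ.- 1ℤ) N
        ≈⟨ +-congˡ {dSum e m N} (≋-trans (termSum-reflect sign (λ j → e j ℤ.+ + 2 ℤ.* (+ suc T ℤ.- κ m j)) T (λ j → κ m j ℤ.- 1ℤ) N)
             (≋-trans (termSum-cong T N sign-neg e-eq κ-reflect) (termSum-raise sign e′ T (κ m) (suc m) N (λ j _ → e′≥0 j)))) ⟩
      dSum e m N ⊕ x ⊛ dSum e′ m N
        ∎
      where open ≋-Reasoning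

    κ′-vanishes₋ : ∀ T₀ s₀ → κ′ (ℤ.- (1ℤ ℤ.+ (M ℤ.+ S)))
                           ≡ + T₀ ℤ.+ (1ℤ ℤ.+ + s₀) → gaussℤ T₀ (κ′ (ℤ.- + N)) ≋ zeroPS
    κ′-vanishes₋ T₀ s₀ eq = subst (λ N → gaussℤ T₀ (κ′ (ℤ.- + N)) ≋ zeroPS) 1+m+s≡N (gaussℤ-above T₀ s₀ eq)

    κ′-vanishes₊ : ∀ T₀ → gaussℤ T₀ (κ′ (+ suc N)) ≋ zeroPS
    κ′-vanishes₊ T₀ = subst (λ N → gaussℤ T₀ (κ′ (+ suc N)) ≋ zeroPS) 1+m+s≡N (gaussℤ-below T₀ (suc (m ℕ.+ (s ℕ.+ s))) (eq M S))
      where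
      eq : ∀ M S → 1ℤ ℤ.+ (1ℤ ℤ.+ M) ℤ.- + 2 ℤ.* (1ℤ ℤ.+ (1ℤ ℤ.+ (M ℤ.+ S)))
                 ≡ ℤ.- (1ℤ ℤ.+ (1ℤ ℤ.+ (M ℤ.+ (S ℤ.+ S))))
      eq = solve-∀

    r : ℤ → ℤ
    r j = e₁ j ℤ.+ + 2 ℤ.* κ′ j
    Z : PS
    Z = termSum sign r (suc T) κ′ N
    Z≈-Z : Z ≋ negPS Z
    Z≈-Z = ≋-trans (termSum-sign-reflect r (suc T) κ′ N (κ′-vanishes₋ (suc T) (suc (m ℕ.+ (s ℕ.+ s))) (eq₋ M S)) (κ′-vanishes₊ (suc T)))
                   (-‿cong (termSum-cong {g = sign} (suc T) N (λ _ → refl) r-symmetric κ′-symmetric))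
      where
      eq₋ : ∀ M S → 1ℤ ℤ.+ (1ℤ ℤ.+ M) ℤ.- + 2 ℤ.* ℤ.- (1ℤ ℤ.+ (M ℤ.+ S))
                  ≡ 1ℤ ℤ.+ (1ℤ ℤ.+ (M ℤ.+ (M ℤ.+ 0ℤ))) ℤ.+ (1ℤ ℤ.+ (1ℤ ℤ.+ (M ℤ.+ (S ℤ.+ S))))
      eq₋ = solve-∀
      r-symmetric : ∀ j → r (1ℤ ℤ.+ ℤ.- j) ≡ r j
      r-symmetric j = eq M j
        where
        eq : ∀ M j → (1ℤ ℤ.+ ℤ.- j) ℤ.* (+ 5 ℤ.* (1ℤ ℤ.+ ℤ.- j) ℤ.- + 1) ℤ.+ + 2 ℤ.* (1ℤ ℤ.+ (1ℤ ℤ.+ M) ℤ.- + 2 ℤ.* (1ℤ ℤ.+ ℤ.- j))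
                   ≡ j ℤ.* (+ 5 ℤ.* j ℤ.- + 1) ℤ.+ + 2 ℤ.* (1ℤ ℤ.+ (1ℤ ℤ.+ M) ℤ.- + 2 ℤ.* j)
        eq = solve-∀
      κ′-symmetric : ∀ j → + suc T ℤ.- κ′ (1ℤ ℤ.+ ℤ.- j) ≡ κ′ j
      κ′-symmetric j = eq M j
        where
        eq : ∀ M j → 1ℤ ℤ.+ (1ℤ ℤ.+ (M ℤ.+ (M ℤ.+ 0ℤ))) ℤ.- (1ℤ ℤ.+ (1ℤ ℤ.+ M) ℤ.- + 2 ℤ.* (1ℤ ℤ.+ ℤ.- j))
                   ≡ 1ℤ ℤ.+ (1ℤ ℤ.+ M) ℤ.- + 2 ℤ.* j
        eq = solve-∀
    e₁-reflect : ∀ j → e₁ (ℤ.- j) ℤ.+ + 2 ℤ.* (+ suc T ℤ.- κ m (ℤ.- j)) ≡ e₀ j ℤ.+ + 2 ℤ.* + suc m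
    e₁-reflect j = eq M j
      where
      eq : ∀ M j → ℤ.- j ℤ.* (+ 5 ℤ.* ℤ.- j ℤ.- + 1) ℤ.+ + 2 ℤ.* (1ℤ ℤ.+ (1ℤ ℤ.+ (M ℤ.+ (M ℤ.+ 0ℤ))) ℤ.- (1ℤ ℤ.+ M ℤ.- + 2 ℤ.* ℤ.- j))
                 ≡ j ℤ.* (+ 5 ℤ.* j ℤ.- + 3) ℤ.+ + 2 ℤ.* (1ℤ ℤ.+ M)
      eq = solve-∀

    p : ℤ → ℤ
    p j = e₀ j ℤ.+ + 2 ℤ.* κ′ j
    p′ : ℤ → ℤ
    p′ j = p j ℤ.+ + 2 ℤ.* (+ suc T ℤ.- κ′ j)

    e₀-reflect : ∀ j → e₀ (ℤ.- j) ℤ.+ + 2 ℤ.* (+ suc T ℤ.- κ m (ℤ.- j)) ≡ e₁ j ℤ.+ + 2 ℤ.* + suc m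
    e₀-reflect j = eq M j
      where
      eq : ∀ M j → ℤ.- j ℤ.* (+ 5 ℤ.* ℤ.- j ℤ.- + 3) ℤ.+ + 2 ℤ.* (1ℤ ℤ.+ (1ℤ ℤ.+ (M ℤ.+ (M ℤ.+ 0ℤ))) ℤ.- (1ℤ ℤ.+ M ℤ.- + 2 ℤ.* ℤ.- j))
                 ≡ j ℤ.* (+ 5 ℤ.* j ℤ.- + 1) ℤ.+ + 2 ℤ.* (1ℤ ℤ.+ M)
      eq = solve-∀

    p-nonneg : ∀ j → 0ℤ ℤ.≤ p j
    p-nonneg j = subst (0ℤ ℤ.≤_) (sym (eq M j)) (ℤP.+-mono-≤ (e₀-nonneg (1ℤ ℤ.+ ℤ.- j)) (+≤+ z≤n))
      where
      eq : ∀ M j → j ℤ.* (+ 5 ℤ.* j ℤ.- + 3) ℤ.+ + 2 ℤ.* (1ℤ ℤ.+ (1ℤ ℤ.+ M) ℤ.- + 2 ℤ.* j)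
                   ≡ (1ℤ ℤ.+ ℤ.- j) ℤ.* (+ 5 ℤ.* (1ℤ ℤ.+ ℤ.- j) ℤ.- + 3) ℤ.+ (+ 2 ℤ.+ (M ℤ.+ M))
      eq = solve-∀

    reflected-part : termSum sign p T κ′ N ≋ negPS (x ⊛ dSum e₀ m N)
    reflected-part = begin
      termSum sign p T κ′ N
        ≈⟨ termSum-sign-reflect p T κ′ N (κ′-vanishes₋ T (suc (suc (m ℕ.+ (s ℕ.+ s)))) (eq₋ M S)) (κ′-vanishes₊ T) ⟩
      negPS (termSum sign (λ j → p (1ℤ ℤ.+ ℤ.- j)) T (λ j → + T ℤ.- κ′ (1ℤ ℤ.+ ℤ.- j)) N)
        ≈⟨ -‿cong (termSum-cong {g = sign} T N (λ _ → refl) p-reflect κ′-reflect) ⟩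
      negPS (termSum sign (λ j → e₀ j ℤ.+ + 2 ℤ.* + suc m) T (κ m) N)
        ≈⟨ -‿cong (termSum-raise sign e₀ T (κ m) (suc m) N (λ j _ → e₀-nonneg j)) ⟩
      negPS (x ⊛ dSum e₀ m N)
        ∎
      where
      open ≋-Reasoning
      eq₋ : ∀ M S → 1ℤ ℤ.+ (1ℤ ℤ.+ M) ℤ.- + 2 ℤ.* ℤ.- (1ℤ ℤ.+ (M ℤ.+ S))
                  ≡ 1ℤ ℤ.+ (M ℤ.+ (M ℤ.+ 0ℤ)) ℤ.+ (1ℤ ℤ.+ (1ℤ ℤ.+ (1ℤ ℤ.+ (M ℤ.+ (S ℤ.+ S)))))
      eq₋ = solve-∀
      p-reflect : ∀ j → p (1ℤ ℤ.+ ℤ.- j) ≡ e₀ j ℤ.+ + 2 ℤ.* + suc m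
      p-reflect j = eq M j
        where
        eq : ∀ M j → (1ℤ ℤ.+ ℤ.- j) ℤ.* (+ 5 ℤ.* (1ℤ ℤ.+ ℤ.- j) ℤ.- + 3) ℤ.+ + 2 ℤ.* (1ℤ ℤ.+ (1ℤ ℤ.+ M) ℤ.- + 2 ℤ.* (1ℤ ℤ.+ ℤ.- j))
                   ≡ j ℤ.* (+ 5 ℤ.* j ℤ.- + 3) ℤ.+ + 2 ℤ.* (1ℤ ℤ.+ M)
        eq = solve-∀
      κ′-reflect : ∀ j → + T ℤ.- κ′ (1ℤ ℤ.+ ℤ.- j) ≡ κ m j
      κ′-reflect j = eq M j
        where
        eq : ∀ M j → 1ℤ ℤ.+ (M ℤ.+ (M ℤ.+ 0ℤ)) ℤ.- (1ℤ ℤ.+ (1ℤ ℤ.+ M) ℤ.- + 2 ℤ.* (1ℤ ℤ.+ ℤ.- j))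
                   ≡ 1ℤ ℤ.+ M ℤ.- + 2 ℤ.* j
        eq = solve-∀

    raised-part : termSum sign p′ T (λ j → κ′ j ℤ.- 1ℤ) N ≋ x ⊛ x ⊛ dSum e₀ m N
    raised-part = begin
      termSum sign p′ T (λ j → κ′ j ℤ.- 1ℤ) N
        ≈⟨ termSum-cong {g = sign} T N (λ _ → refl) p′≡ κ′-1≡κ ⟩
      termSum sign (λ j → e₀ j ℤ.+ + 2 ℤ.* + (suc m ℕ.+ suc m)) T (κ m) N
        ≈⟨ termSum-raise sign e₀ T (κ m) (suc m ℕ.+ suc m) N (λ j _ → e₀-nonneg j) ⟩
      mon (suc m ℕ.+ suc m) ⊛ dSum e₀ m N
        ≈⟨ ⊛-congʳ (dSum e₀ m N) (≋-sym (mon-+ (suc m) (suc m))) ⟩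
      x ⊛ x ⊛ dSum e₀ m N
        ∎
      where
      open ≋-Reasoning
      p′≡ : ∀ j → p′ j ≡ e₀ j ℤ.+ + 2 ℤ.* + (suc m ℕ.+ suc m)
      p′≡ j = eq M j
        where
        eq : ∀ M j → j ℤ.* (+ 5 ℤ.* j ℤ.- + 3) ℤ.+ + 2 ℤ.* (1ℤ ℤ.+ (1ℤ ℤ.+ M) ℤ.- + 2 ℤ.* j)
                       ℤ.+ + 2 ℤ.* (1ℤ ℤ.+ (1ℤ ℤ.+ (M ℤ.+ (M ℤ.+ 0ℤ))) ℤ.- (1ℤ ℤ.+ (1ℤ ℤ.+ M) ℤ.- + 2 ℤ.* j))
                   ≡ j ℤ.* (+ 5 ℤ.* j ℤ.- + 3) ℤ.+ + 2 ℤ.* ((1ℤ ℤ.+ M) ℤ.+ (1ℤ ℤ.+ M))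
        eq = solve-∀

  dSum₁-suc : dSum e₁ (suc m) N ≋ dSum e₁ m N ⊕ x ⊛ dSum e₀ m N
  dSum₁-suc = begin
    dSum e₁ (suc m) N
      ≈⟨ dSum-at-suc e₁ ⟩
    termSum sign e₁ (suc (suc T)) κ′ N
      ≈⟨ termSum-pascal₂ sign e₁ (suc T) κ′ N (λ j _ → e₁-nonneg j) ⟩
    termSum sign e₁ (suc T) (λ j → κ′ j ℤ.- 1ℤ) N ⊕ Z
      ≈⟨ ⊕-cong (termSum-cong {g = sign} {e = e₁} (suc T) N (λ _ → refl) (λ _ → refl) κ′-1≡κ) (x≈-x⇒x≈0 Z≈-Z) ⟩
    termSum sign e₁ (suc T) (κ m) N ⊕ zeroPS
      ≈⟨ +-identityʳ _ ⟩
    termSum sign e₁ (suc T) (κ m) N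
      ≈⟨ pascal-reflect e₁ e₀ e₁-reflect e₁-nonneg e₀-nonneg ⟩
    dSum e₁ m N ⊕ x ⊛ dSum e₀ m N
      ∎
    where open ≋-Reasoning

  dSum₀-suc : dSum e₀ (suc m) N ≋ dSum e₀ m N ⊕ x ⊛ dSum e₁ m N ⊖ x ⊛ dSum e₀ m N ⊕ x ⊛ x ⊛ dSum e₀ m N
  dSum₀-suc = begin
    dSum e₀ (suc m) N
      ≈⟨ dSum-at-suc e₀ ⟩
    termSum sign e₀ (suc (suc T)) κ′ N
      ≈⟨ termSum-pascal₂ sign e₀ (suc T) κ′ N (λ j _ → e₀-nonneg j) ⟩
    termSum sign e₀ (suc T) (λ j → κ′ j ℤ.- 1ℤ) N ⊕ termSum sign p (suc T) κ′ N
      ≈⟨ +-congʳ {termSum sign p (suc T) κ′ N} (termSum-cong {g = sign} {e = e₀} (suc T) N (λ _ → refl) (λ _ → refl) κ′-1≡κ) ⟩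
    termSum sign e₀ (suc T) (κ m) N ⊕ termSum sign p (suc T) κ′ N
      ≈⟨ ⊕-cong (pascal-reflect e₀ e₁ e₀-reflect e₀-nonneg e₁-nonneg) (termSum-pascal₁ sign p T κ′ N (λ j _ → p-nonneg j)) ⟩
    (dSum e₀ m N ⊕ x ⊛ dSum e₁ m N) ⊕ (termSum sign p T κ′ N ⊕ termSum sign p′ T (λ j → κ′ j ℤ.- 1ℤ) N)
      ≈⟨ +-congˡ {dSum e₀ m N ⊕ x ⊛ dSum e₁ m N} (⊕-cong reflected-part raised-part) ⟩
    (dSum e₀ m N ⊕ x ⊛ dSum e₁ m N) ⊕ (negPS (x ⊛ dSum e₀ m N) ⊕ x ⊛ x ⊛ dSum e₀ m N)
      ≈⟨ solve 4 (λ A B C D → (A :+ B) :+ (:- C :+ D) := A :+ B :- C :+ D) ≋-refl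
           (dSum e₀ m N) (x ⊛ dSum e₁ m N) (x ⊛ dSum e₀ m N) (x ⊛ x ⊛ dSum e₀ m N) ⟩
    dSum e₀ m N ⊕ x ⊛ dSum e₁ m N ⊖ x ⊛ dSum e₀ m N ⊕ x ⊛ x ⊛ dSum e₀ m N
      ∎
    where open ≋-Reasoning

-- The sums C

ε : ℕ → ℤ → ℤ
ε a j = + 2 ℤ.* (j ℤ.* j ℤ.+ + a ℤ.* j)

ε-nonneg : ∀ a → ExponentNonneg (ε a) (λ j → j)
ε-nonneg a (+ b) _ = subst (0ℤ ℤ.≤_) (sym is-nat) (+≤+ z≤n)
  where
  is-nat : ε a (+ b) ≡ + (2 ℕ.* (b ℕ.* b ℕ.+ a ℕ.* b))
  is-nat = trans (cong₂ (λ u v → + 2 ℤ.* (u ℤ.+ v)) (sym (ℤP.pos-* b b)) (sym (ℤP.pos-* a b)))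
                 (sym (ℤP.pos-* 2 (b ℕ.* b ℕ.+ a ℕ.* b)))

half-ε₁ : ∀ k → half (ε 1 (+ k)) ≡ k ℕ.* k ℕ.+ k
half-ε₁ k = begin
  ∣ + 2 ℤ.* (+ k ℤ.* + k ℤ.+ + 1 ℤ.* + k) ∣ ℕ./ 2
    ≡⟨ cong (λ z → ∣ + 2 ℤ.* z ∣ ℕ./ 2) (cong₂ ℤ._+_ (sym (ℤP.pos-* k k)) (ℤP.*-identityˡ (+ k))) ⟩
  ∣ + 2 ℤ.* + (k ℕ.* k ℕ.+ k) ∣ ℕ./ 2
    ≡⟨ cong (λ z → ∣ z ∣ ℕ./ 2) (sym (ℤP.pos-* 2 (k ℕ.* k ℕ.+ k))) ⟩
  2 ℕ.* (k ℕ.* k ℕ.+ k) ℕ./ 2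
    ≡⟨ cong (ℕ._/ 2) (ℕP.*-comm 2 (k ℕ.* k ℕ.+ k)) ⟩
  (k ℕ.* k ℕ.+ k) ℕ.* 2 ℕ./ 2
    ≡⟨ m*n/n≡m (k ℕ.* k ℕ.+ k) 2 ⟩
  k ℕ.* k ℕ.+ k
    ∎
  where open ≡-Reasoning

one : ℤ → ℤ
one _ = 1ℤ

cSum : ℕ → ℕ → ℕ → PS
cSum m a N = termSum one (ε a) m (λ j → j) N

module CSumRecurrence (m N : ℕ) (m<N : m ℕ.< N) where
  private
    shift-down : ∀ e → termSum one e m (λ j → j ℤ.- 1ℤ) N ≋ termSum one (λ j → e (1ℤ ℤ.+ j)) m (λ j → j) N
    shift-down e = ≋-trans
      (termSum-shift one e m (λ j → j ℤ.- 1ℤ) N (below m<N) (gauss-> m N m<N))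
      (termSum-cong {g = one} {e = λ j → e (1ℤ ℤ.+ j)} m N (λ _ → refl) (λ _ → refl) eqₖ)
      where
      below : ∀ {N} → m ℕ.< N → gaussℤ m (ℤ.- + N ℤ.- 1ℤ) ≋ zeroPS
      below (ℕ.s≤s _) = ≋-refl
      eqₖ : ∀ j → 1ℤ ℤ.+ j ℤ.- 1ℤ ≡ j
      eqₖ = solve-∀

  cSum-pascal₁ : ∀ a → cSum (suc m) a N ≋ cSum m a N ⊕ mon (suc m ℕ.+ a) ⊛ cSum m (suc a) N
  cSum-pascal₁ a = begin
    cSum (suc m) a N
      ≈⟨ termSum-pascal₁ one (ε a) m (λ j → j) N (ε-nonneg a) ⟩
    cSum m a N ⊕ termSum one (λ j → ε a j ℤ.+ + 2 ℤ.* (+ suc m ℤ.- j)) m (λ j → j ℤ.- 1ℤ) N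
      ≈⟨ +-congˡ {cSum m a N} (shift-down (λ j → ε a j ℤ.+ + 2 ℤ.* (+ suc m ℤ.- j))) ⟩
    cSum m a N ⊕ termSum one (λ j → ε a (1ℤ ℤ.+ j) ℤ.+ + 2 ℤ.* (+ suc m ℤ.- (1ℤ ℤ.+ j))) m (λ j → j) N
      ≈⟨ +-congˡ {cSum m a N} (≋-trans (termSum-cong {g = one} {k = λ j → j} m N (λ _ → refl) ε≡ (λ _ → refl))
                                        (termSum-raise one (ε (suc a)) m (λ j → j) (suc m ℕ.+ a) N (ε-nonneg (suc a)))) ⟩
    cSum m a N ⊕ mon (suc m ℕ.+ a) ⊛ cSum m (suc a) N
      ∎
    where
    open ≋-Reasoning
    ε≡ : ∀ j → ε a (1ℤ ℤ.+ j) ℤ.+ + 2 ℤ.* (+ suc m ℤ.- (1ℤ ℤ.+ j)) ≡ ε (suc a) j ℤ.+ + 2 ℤ.* + (suc m ℕ.+ a)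
    ε≡ j = eq (+ m) (+ a) j
      where
      eq : ∀ M A j → + 2 ℤ.* ((1ℤ ℤ.+ j) ℤ.* (1ℤ ℤ.+ j) ℤ.+ A ℤ.* (1ℤ ℤ.+ j)) ℤ.+ + 2 ℤ.* ((1ℤ ℤ.+ M) ℤ.- (1ℤ ℤ.+ j))
                     ≡ + 2 ℤ.* (j ℤ.* j ℤ.+ (1ℤ ℤ.+ A) ℤ.* j) ℤ.+ + 2 ℤ.* ((1ℤ ℤ.+ M) ℤ.+ A)
      eq = solve-∀

  cSum-pascal₂ : ∀ a → cSum (suc m) a N ≋ cSum m (suc a) N ⊕ mon (suc a) ⊛ cSum m (2 ℕ.+ a) N
  cSum-pascal₂ a = begin
    cSum (suc m) a N
      ≈⟨ termSum-pascal₂ one (ε a) m (λ j → j) N (ε-nonneg a) ⟩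
    termSum one (ε a) m (λ j → j ℤ.- 1ℤ) N ⊕ termSum one (λ j → ε a j ℤ.+ + 2 ℤ.* j) m (λ j → j) N
      ≈⟨ ⊕-cong (shift-down (ε a)) (termSum-cong {g = one} {k = λ j → j} m N (λ _ → refl) ε≡₁ (λ _ → refl)) ⟩
    termSum one (λ j → ε a (1ℤ ℤ.+ j)) m (λ j → j) N ⊕ cSum m (suc a) N
      ≈⟨ +-congʳ {cSum m (suc a) N} (≋-trans (termSum-cong {g = one} {k = λ j → j} m N (λ _ → refl) ε≡₂ (λ _ → refl))
                                              (termSum-raise one (ε (2 ℕ.+ a)) m (λ j → j) (suc a) N (ε-nonneg (2 ℕ.+ a)))) ⟩
    mon (suc a) ⊛ cSum m (2 ℕ.+ a) N ⊕ cSum m (suc a) N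
      ≈⟨ +-comm (mon (suc a) ⊛ cSum m (2 ℕ.+ a) N) (cSum m (suc a) N) ⟩
    cSum m (suc a) N ⊕ mon (suc a) ⊛ cSum m (2 ℕ.+ a) N
      ∎
    where
    open ≋-Reasoning
    ε≡₁ : ∀ j → ε a j ℤ.+ + 2 ℤ.* j ≡ ε (suc a) j
    ε≡₁ j = eq (+ a) j
      where
      eq : ∀ A j → + 2 ℤ.* (j ℤ.* j ℤ.+ A ℤ.* j) ℤ.+ + 2 ℤ.* j ≡ + 2 ℤ.* (j ℤ.* j ℤ.+ (1ℤ ℤ.+ A) ℤ.* j)
      eq = solve-∀
    ε≡₂ : ∀ j → ε a (1ℤ ℤ.+ j) ≡ ε (2 ℕ.+ a) j ℤ.+ + 2 ℤ.* + suc a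
    ε≡₂ j = eq (+ a) j
      where
      eq : ∀ A j → + 2 ℤ.* ((1ℤ ℤ.+ j) ℤ.* (1ℤ ℤ.+ j) ℤ.+ A ℤ.* (1ℤ ℤ.+ j))
                   ≡ + 2 ℤ.* (j ℤ.* j ℤ.+ (1ℤ ℤ.+ (1ℤ ℤ.+ A)) ℤ.* j) ℤ.+ + 2 ℤ.* (1ℤ ℤ.+ A)
      eq = solve-∀

-- Truncation windows, and C and D as such sums

termSum-stable : ∀ g e T k m → (∀ {N} → m ≤ N → gaussℤ T (k (+ suc N)) ≋ zeroPS × gaussℤ T (k -[1+ N ]) ≋ zeroPS) →
              ∀ {N} → m ≤ N → termSum g e T k N ≋ termSum g e T k m
termSum-stable g e T k m vanish m≤N = go (ℕP.≤⇒≤′ m≤N)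
  where
  go : ∀ {N} → m ≤′ N → termSum g e T k N ≋ termSum g e T k m
  go ≤′-refl               = ≋-refl
  go (≤′-step {N} m≤′N) with vanish (ℕP.≤′⇒≤ m≤′N)
  ... | G₊≈0 , G₋≈0 = ≋-trans (termSum-extend g e T k N G₊≈0 G₋≈0) (go m≤′N)

cSum-stable : ∀ m a {N} → m ≤ N → cSum m a N ≋ cSum m a m
cSum-stable m a = termSum-stable one (ε a) m (λ j → j) m (λ {N} m≤N → gauss-> m (suc N) (s≤s m≤N) , ≋-refl)

dSum-stable : ∀ e m {N} → m ≤ N → dSum e m N ≋ dSum e m m
dSum-stable e m = termSum-stable sign e (suc (2 ℕ.* m)) (κ m) m vanish
  where
  vanish : ∀ {N} → m ≤ N → gaussℤ (suc (2 ℕ.* m)) (κ m (+ suc N)) ≋ zeroPS × gaussℤ (suc (2 ℕ.* m)) (κ m -[1+ N ]) ≋ zeroPS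
  vanish m≤N with ℕP.m≤n⇒∃[o]m+o≡n m≤N
  ... | s , refl = gaussℤ-below (suc (2 ℕ.* m)) (m ℕ.+ (s ℕ.+ s)) (eq₊ (+ m) (+ s))
                 , gaussℤ-above (suc (2 ℕ.* m)) (suc (m ℕ.+ (s ℕ.+ s))) (eq₋ (+ m) (+ s))
    where
    eq₊ : ∀ M S → 1ℤ ℤ.+ M ℤ.- + 2 ℤ.* (1ℤ ℤ.+ (M ℤ.+ S)) ≡ ℤ.- (1ℤ ℤ.+ (M ℤ.+ (S ℤ.+ S)))
    eq₊ = solve-∀
    eq₋ : ∀ M S → 1ℤ ℤ.+ M ℤ.- + 2 ℤ.* ℤ.- (1ℤ ℤ.+ (M ℤ.+ S))
                ≡ 1ℤ ℤ.+ (M ℤ.+ (M ℤ.+ 0ℤ)) ℤ.+ (1ℤ ℤ.+ (1ℤ ℤ.+ (M ℤ.+ (S ℤ.+ S))))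
    eq₋ = solve-∀

sumPS-applyUpTo-cong : ∀ {F G} L → (∀ i → F i ≋ G i) → sumPS (applyUpTo F L) ≋ sumPS (applyUpTo G L)
sumPS-applyUpTo-cong zero    F≈G = ≋-refl
sumPS-applyUpTo-cong (suc L) F≈G = ⊕-cong (F≈G 0) (sumPS-applyUpTo-cong L (λ i → F≈G (suc i)))

sumPS-applyUpTo-suc : ∀ F L → sumPS (applyUpTo F (suc L)) ≋ sumPS (applyUpTo F L) ⊕ F L
sumPS-applyUpTo-suc F zero    = ≋-trans (+-identityʳ (F 0)) (≋-sym (+-identityˡ (F 0)))
sumPS-applyUpTo-suc F (suc L) = ≋-trans (+-congˡ {F 0} (sumPS-applyUpTo-suc (λ i → F (suc i)) L))
                                        (≋-sym (+-assoc (F 0) (sumPS (applyUpTo (λ i → F (suc i)) L)) (F (suc L))))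

symSum-from-zero : ∀ f N → (∀ i → f -[1+ i ] ≋ zeroPS) → symSum f N ≋ sumPS (applyUpTo (λ k → f (+ k)) (suc N))
symSum-from-zero f zero    _    = ≋-sym (+-identityʳ (f (+ 0)))
symSum-from-zero f (suc N) f₋≈0 = begin
  symSum f N ⊕ f (+ suc N) ⊕ f -[1+ N ]                    ≈⟨ a+b≈a _ (f₋≈0 N) ⟩
  symSum f N ⊕ f (+ suc N)                                ≈⟨ +-congʳ {f (+ suc N)} (symSum-from-zero f N f₋≈0) ⟩
  sumPS (applyUpTo (λ k → f (+ k)) (suc N)) ⊕ f (+ suc N)  ≈⟨ ≋-sym (sumPS-applyUpTo-suc (λ k → f (+ k)) (suc N)) ⟩
  sumPS (applyUpTo (λ k → f (+ k)) (suc (suc N)))          ∎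
  where open ≋-Reasoning

symSum-as-list : ∀ G M → sumPS (applyUpTo (λ i → G (+ i ℤ.- + M)) (suc (M ℕ.+ M))) ≋ symSum G M
symSum-as-list G zero    = +-identityʳ (G (+ 0))
symSum-as-list G (suc M) = begin
  G -[1+ M ] ⊕ sumPS (applyUpTo F (suc M ℕ.+ suc M))
    ≈⟨ +-congˡ {G -[1+ M ]} (λ i → cong (λ L → sumPS (applyUpTo F L) i) (cong suc (ℕP.+-suc M M))) ⟩
  G -[1+ M ] ⊕ sumPS (applyUpTo F (suc (suc (M ℕ.+ M))))
    ≈⟨ +-congˡ {G -[1+ M ]} (sumPS-applyUpTo-suc F (suc (M ℕ.+ M))) ⟩
  G -[1+ M ] ⊕ (sumPS (applyUpTo F (suc (M ℕ.+ M))) ⊕ F (suc (M ℕ.+ M)))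
    ≈⟨ +-congˡ {G -[1+ M ]} (⊕-cong (sumPS-applyUpTo-cong (suc (M ℕ.+ M)) (λ i n → cong (λ j → G j n) (shift-both (+ i) (+ M))))
                                     (λ n → cong (λ j → G j n) (last-index (+ M)))) ⟩
  G -[1+ M ] ⊕ (sumPS (applyUpTo (λ i → G (+ i ℤ.- + M)) (suc (M ℕ.+ M))) ⊕ G (+ suc M))
    ≈⟨ +-congˡ {G -[1+ M ]} (+-congʳ {G (+ suc M)} (symSum-as-list G M)) ⟩
  G -[1+ M ] ⊕ (symSum G M ⊕ G (+ suc M))
    ≈⟨ +-comm (G -[1+ M ]) (symSum G M ⊕ G (+ suc M)) ⟩
  symSum G (suc M)
    ∎
  where
  open ≋-Reasoning
  F : ℕ → PS
  F i = G (+ suc i ℤ.- + suc M)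
  shift-both : ∀ I M → 1ℤ ℤ.+ I ℤ.- (1ℤ ℤ.+ M) ≡ I ℤ.- M
  shift-both = solve-∀
  last-index : ∀ M → 1ℤ ℤ.+ (1ℤ ℤ.+ (M ℤ.+ M)) ℤ.- (1ℤ ℤ.+ M) ≡ 1ℤ ℤ.+ M
  last-index = solve-∀

C≋cSum : ∀ n → C n ≋ cSum n 1 n
C≋cSum n = begin
  C n
    ≈⟨ (λ i → cong (λ xs → sumPS xs i) (map-upTo (λ k → mon (k ℕ.* k ℕ.+ k) ⊛ gauss n k) (suc n))) ⟩
  sumPS (applyUpTo (λ k → mon (k ℕ.* k ℕ.+ k) ⊛ gauss n k) (suc n))
    ≈⟨ sumPS-applyUpTo-cong (suc n) (λ k → ≋-sym (summand k)) ⟩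
  sumPS (applyUpTo (λ k → term 1ℤ (ε 1 (+ k)) n (+ k)) (suc n))
    ≈⟨ ≋-sym (symSum-from-zero (λ j → term 1ℤ (ε 1 j) n j) n (λ i → term-vanishing 1ℤ (ε 1 -[1+ i ]) n -[1+ i ] ≋-refl)) ⟩
  cSum n 1 n
    ∎
  where
  open ≋-Reasoning
  summand : ∀ k → term 1ℤ (ε 1 (+ k)) n (+ k) ≋ mon (k ℕ.* k ℕ.+ k) ⊛ gauss n k
  summand k = ⊛-congʳ (gauss n k) (≋-trans (⊛-identityˡ _) (λ i → cong (λ e → mon e i) (half-ε₁ k)))

D≋dSum : ∀ n → D n ≋ dSum e₀ n (suc n)
D≋dSum n = begin
  D n
    ≈⟨ (λ i → cong (λ xs → sumPS xs i) (trans (sym (map-∘ {g = G} {f = φ} (upTo L))) (map-upTo (λ i → G (φ i)) L))) ⟩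
  sumPS (applyUpTo (λ i → G (φ i)) L)
    ≈⟨ (λ i → cong (λ L′ → sumPS (applyUpTo (λ i → G (φ i)) L′) i) L≡) ⟩
  sumPS (applyUpTo (λ i → G (φ i)) (suc (suc n ℕ.+ suc n)))
    ≈⟨ symSum-as-list G (suc n) ⟩
  dSum e₀ n (suc n)
    ∎
  where
  open ≋-Reasoning
  G : ℤ → PS
  G j = term (sign j) (e₀ j) (suc (2 ℕ.* n)) (κ n j)
  φ : ℕ → ℤ
  φ i = + i ℤ.- + suc n
  L : ℕ
  L = suc (suc (suc (2 ℕ.* n)))
  L≡ : L ≡ suc (suc n ℕ.+ suc n)
  L≡ = cong (λ x → suc (suc x)) (trans (cong (λ x → suc (n ℕ.+ x)) (ℕP.+-identityʳ n)) (sym (ℕP.+-suc n n)))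

-- The recursion

-- the recursion operator at n = k + 2, written in q and x = q^(k+1), so that q^n = qx
residual : PS → PS → PS → PS → PS → PS
residual q x U V A = U ⊖ (onePS ⊕ q ⊖ q ⊛ x ⊕ q ⊛ x ⊛ (q ⊛ x)) ⊛ V ⊕ q ⊛ (onePS ⊖ x) ⊛ A

recOp≈residual : ∀ X k → recOp X (2 ℕ.+ k) ≋ residual (mon 1) (mon (suc k)) (X (2 ℕ.+ k)) (X (suc k)) (X k)
recOp≈residual X k = +-congʳ {mon 1 ⊛ (onePS ⊖ mon (suc k)) ⊛ X k} (+-congˡ {X n} (-‿cong (⊛-congʳ (X (suc k)) coefficient)))
  where
  n : ℕ
  n = 2 ℕ.+ k
  qⁿ≈qx : mon n ≋ mon 1 ⊛ mon (suc k)
  qⁿ≈qx = ≋-sym (mon-+ 1 (suc k))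
  coefficient : onePS ⊕ mon 1 ⊖ mon n ⊕ mon (2 ℕ.* n) ≋ onePS ⊕ mon 1 ⊖ mon 1 ⊛ mon (suc k) ⊕ mon 1 ⊛ mon (suc k) ⊛ (mon 1 ⊛ mon (suc k))
  coefficient = ⊕-cong (+-congˡ {onePS ⊕ mon 1} (-‿cong qⁿ≈qx))
    (≋-trans (λ i → cong (λ e → mon (n ℕ.+ e) i) (ℕP.+-identityʳ n)) (≋-trans (≋-sym (mon-+ n n)) (⊛-cong qⁿ≈qx qⁿ≈qx)))

residual-cong : ∀ q x {U U′ V V′ A A′} → U ≋ U′ → V ≋ V′ → A ≋ A′ → residual q x U V A ≋ residual q x U′ V′ A′
residual-cong q x U≈ V≈ A≈ =
  ⊕-cong (⊕-cong U≈ (-‿cong (⊛-congˡ (onePS ⊕ q ⊖ q ⊛ x ⊕ q ⊛ x ⊛ (q ⊛ x)) V≈))) (⊛-congˡ (q ⊛ (onePS ⊖ x)) A≈)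

-- residual = u + q²x w - q²x² v₂ - q(1 - x) v₁, where u, w, v₂, v₁ are the defects of the four relations
residual-vanishes-C : ∀ q x A B G V W U →
  V ≋ A ⊕ x ⊛ q ⊛ B → V ≋ B ⊕ q ⊛ q ⊛ G → W ≋ B ⊕ x ⊛ (q ⊛ q) ⊛ G → U ≋ V ⊕ q ⊛ x ⊛ q ⊛ W →
  residual q x U V A ≋ zeroPS
residual-vanishes-C q x A B G V W U V≈₁ V≈₂ W≈ U≈ = begin
  residual q x U V A
    ≈⟨ solve 8 (λ q x A B G V W U →
          U :- (con 1ℤ :+ q :- q :* x :+ q :* x :* (q :* x)) :* V :+ q :* (con 1ℤ :- x) :* A
          := con 1ℤ :* (con 1ℤ :* (U :- (V :+ q :* x :* q :* W)) :+ q :* x :* q :* (W :- (B :+ x :* (q :* q) :* G)))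
             :+ con 1ℤ :* ((:- (q :* q :* x :* x)) :* (V :- (B :+ q :* q :* G))
                           :+ (:- (q :* (con 1ℤ :- x))) :* (V :- (A :+ x :* q :* B))))
          ≋-refl q x A B G V W U ⟩
  onePS ⊛ (onePS ⊛ (U ⊖ (V ⊕ q ⊛ x ⊛ q ⊛ W)) ⊕ q ⊛ x ⊛ q ⊛ (W ⊖ (B ⊕ x ⊛ (q ⊛ q) ⊛ G)))
    ⊕ onePS ⊛ (negPS (q ⊛ q ⊛ x ⊛ x) ⊛ (V ⊖ (B ⊕ q ⊛ q ⊛ G)) ⊕ negPS (q ⊛ (onePS ⊖ x)) ⊛ (V ⊖ (A ⊕ x ⊛ q ⊛ B)))
    ≈⟨ combination-vanishes onePS onePS
         (combination-vanishes onePS (q ⊛ x ⊛ q) (defect-vanishes U≈) (defect-vanishes W≈))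
         (combination-vanishes (negPS (q ⊛ q ⊛ x ⊛ x)) (negPS (q ⊛ (onePS ⊖ x))) (defect-vanishes V≈₂) (defect-vanishes V≈₁)) ⟩
  zeroPS
    ∎
  where open ≋-Reasoning

-- residual = u + qx w - q v, where u, w, v are the defects of the three relations
residual-vanishes-D : ∀ q x A B V W U →
  V ≋ A ⊕ x ⊛ B ⊖ x ⊛ A ⊕ x ⊛ x ⊛ A → W ≋ B ⊕ x ⊛ A →
  U ≋ V ⊕ q ⊛ x ⊛ W ⊖ q ⊛ x ⊛ V ⊕ q ⊛ x ⊛ (q ⊛ x) ⊛ V →
  residual q x U V A ≋ zeroPS
residual-vanishes-D q x A B V W U V≈ W≈ U≈ = begin
  residual q x U V A
    ≈⟨ solve 7 (λ q x A B V W U →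
          U :- (con 1ℤ :+ q :- q :* x :+ q :* x :* (q :* x)) :* V :+ q :* (con 1ℤ :- x) :* A
          := con 1ℤ :* (con 1ℤ :* (U :- (V :+ q :* x :* W :- q :* x :* V :+ q :* x :* (q :* x) :* V))
                        :+ q :* x :* (W :- (B :+ x :* A)))
             :+ (:- q) :* (V :- (A :+ x :* B :- x :* A :+ x :* x :* A)))
          ≋-refl q x A B V W U ⟩
  onePS ⊛ (onePS ⊛ (U ⊖ (V ⊕ q ⊛ x ⊛ W ⊖ q ⊛ x ⊛ V ⊕ q ⊛ x ⊛ (q ⊛ x) ⊛ V)) ⊕ q ⊛ x ⊛ (W ⊖ (B ⊕ x ⊛ A)))
    ⊕ negPS q ⊛ (V ⊖ (A ⊕ x ⊛ B ⊖ x ⊛ A ⊕ x ⊛ x ⊛ A))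
    ≈⟨ combination-vanishes onePS (negPS q)
         (combination-vanishes onePS (q ⊛ x) (defect-vanishes U≈) (defect-vanishes W≈)) (defect-vanishes V≈) ⟩
  zeroPS
    ∎
  where open ≋-Reasoning

C-recursion : ∀ k → recOp C (2 ℕ.+ k) ≋ zeroPS
C-recursion k = begin
  recOp C (2 ℕ.+ k)
    ≈⟨ recOp≈residual C k ⟩
  residual q x (C (2 ℕ.+ k)) (C (suc k)) (C k)
    ≈⟨ residual-cong q x (C≋cSum (2 ℕ.+ k)) (to-window (suc k) (ℕP.<⇒≤ 1+k<N)) (to-window k (ℕP.<⇒≤ k<N)) ⟩
  residual q x U V A
    ≈⟨ residual-vanishes-C q x A B G V W U V≈₁ V≈₂ W≈ U≈ ⟩
  zeroPS
    ∎
  where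
  open ≋-Reasoning
  N : ℕ
  N = 2 ℕ.+ k
  q x A B G V W U : PS
  q = mon 1
  x = mon (suc k)
  A = cSum k 1 N
  B = cSum k 2 N
  G = cSum k 3 N
  V = cSum (suc k) 1 N
  W = cSum (suc k) 2 N
  U = cSum (2 ℕ.+ k) 1 N
  to-window : ∀ m → m ≤ N → C m ≋ cSum m 1 N
  to-window m m≤N = ≋-trans (C≋cSum m) (≋-sym (cSum-stable m 1 m≤N))
  k<N : k ℕ.< N
  k<N = ℕP.m<n+m k (s≤s z≤n)
  1+k<N : suc k ℕ.< N
  1+k<N = ℕP.n<1+n (suc k)
  V≈₁ : V ≋ A ⊕ x ⊛ q ⊛ B
  V≈₁ = ≋-trans (CSumRecurrence.cSum-pascal₁ k N k<N 1) (+-congˡ {A} (⊛-congʳ B (≋-sym (mon-+ (suc k) 1))))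
  V≈₂ : V ≋ B ⊕ q ⊛ q ⊛ G
  V≈₂ = ≋-trans (CSumRecurrence.cSum-pascal₂ k N k<N 1) (+-congˡ {B} (⊛-congʳ G (≋-sym (mon-+ 1 1))))
  W≈ : W ≋ B ⊕ x ⊛ (q ⊛ q) ⊛ G
  W≈ = ≋-trans (CSumRecurrence.cSum-pascal₁ k N k<N 2) (+-congˡ {B} (⊛-congʳ G (≋-trans (≋-sym (mon-+ (suc k) 2)) (⊛-congˡ x (≋-sym (mon-+ 1 1))))))
  U≈ : U ≋ V ⊕ q ⊛ x ⊛ q ⊛ W
  U≈ = ≋-trans (CSumRecurrence.cSum-pascal₁ (suc k) N 1+k<N 1)
               (+-congˡ {V} (⊛-congʳ W (≋-trans (≋-sym (mon-+ (2 ℕ.+ k) 1)) (⊛-congʳ q (≋-sym (mon-+ 1 (suc k)))))))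

D-recursion : ∀ k → recOp D (2 ℕ.+ k) ≋ zeroPS
D-recursion k = begin
  recOp D (2 ℕ.+ k)
    ≈⟨ recOp≈residual D k ⟩
  residual q x (D (2 ℕ.+ k)) (D (suc k)) (D k)
    ≈⟨ residual-cong q x (D≋dSum (2 ℕ.+ k)) (to-window (suc k) (ℕP.<⇒≤ 1+k<N)) (to-window k (ℕP.<⇒≤ k<N)) ⟩
  residual q x U V A
    ≈⟨ residual-vanishes-D q x A B V W U V≈ W≈ U≈ ⟩
  zeroPS
    ∎
  where
  open ≋-Reasoning
  N : ℕ
  N = 3 ℕ.+ k
  q x A B V W U : PS
  q = mon 1
  x = mon (suc k)
  A = dSum e₀ k N
  B = dSum e₁ k N
  V = dSum e₀ (suc k) N
  W = dSum e₁ (suc k) N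
  U = dSum e₀ (2 ℕ.+ k) N
  k<N : k ℕ.< N
  k<N = ℕP.m<n+m k (s≤s z≤n)
  1+k<N : suc k ℕ.< N
  1+k<N = ℕP.m<n+m (suc k) {2} (s≤s z≤n)
  to-window : ∀ m → m ≤ N → D m ≋ dSum e₀ m N
  to-window m m≤N = ≋-trans (D≋dSum m) (≋-trans (dSum-stable e₀ m (ℕP.n≤1+n m)) (≋-sym (dSum-stable e₀ m m≤N)))
  V≈ : V ≋ A ⊕ x ⊛ B ⊖ x ⊛ A ⊕ x ⊛ x ⊛ A
  V≈ = DSumRecurrence.dSum₀-suc k N k<N
  W≈ : W ≋ B ⊕ x ⊛ A
  W≈ = DSumRecurrence.dSum₁-suc k N k<N
  qx≈ : mon (2 ℕ.+ k) ≋ q ⊛ x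
  qx≈ = ≋-sym (mon-+ 1 (suc k))
  U≈ : U ≋ V ⊕ q ⊛ x ⊛ W ⊖ q ⊛ x ⊛ V ⊕ q ⊛ x ⊛ (q ⊛ x) ⊛ V
  U≈ = ≋-trans (DSumRecurrence.dSum₀-suc (suc k) N 1+k<N)
    (⊕-cong (⊕-cong (+-congˡ {V} (⊛-congʳ W qx≈)) (-‿cong (⊛-congʳ V qx≈))) (⊛-congʳ V (⊛-cong qx≈ qx≈)))

mainTheorem2 : (n : ℕ) → 2 ≤ n → (recOp C n ≋ zeroPS) × (recOp D n ≋ zeroPS)
mainTheorem2 (suc (suc k)) (s≤s (s≤s z≤n)) = C-recursion k , D-recursion k
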